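{- The subspace $\operatorname{sFQSym}$ of $\operatorname{sNCQSym}$ spanned by $\{Q_I: I \text{ a superpermutation}\}$ is a sub-Hopf superalgebra of $\operatorname{sNCQSym}$ (closed under the product and the coproduct $\Delta$).
   Context: $\mathbb{Q}^\theta\langle\langle x\rangle\rangle$: formal power series of bounded degree in noncommuting $x_1,x_2,\ldots$ and $\theta_1,\theta_2,\ldots$ with $x_i\theta_j=\theta_jx_i$, $\theta_i\theta_j=-\theta_j\theta_i$; monomials in normal form $\theta_{i_1}\cdots\theta_{i_m}x_{j_1}\cdots x_{j_n}$, $i_1<\cdots<i_m$. A set supercomposition of bidegree $(n,m)$ is a sequence $I=(I_1,\ldots,I_k)$ of nonempty subsets of $\{0,\ldots,n\}$ with $I_i\cap I_j\subseteq\{0\}$ ($i\ne j$), $\bigcup(I_i\setminus\{0\})=[n]$, and $m$ blocks containing $0$ (fermionic blocks). For a monic monomial $u$, standardize its index set $\operatorname{ind}(u)$ order-preservingly onto $[k]$ to get $\theta_{i_1}\cdots\theta_{i_m}x_{j_1}\cdots x_{j_n}$ and set $I(u)=(I_1,\ldots,I_k)$, $I_r=\{t: j_t=r\}\cup(\{0\}\text{ if }r\in\{i_1,\ldots,i_m\})$. $M_I=\sum_{I(u)=I}u$, and $\operatorname{sNCQSym}$ is the span (in the sense of bounded-degree series) of all $M_I$; it is an algebra under the product of $\mathbb{Q}^\theta\langle\langle x\rangle\rangle$. The standardization $\operatorname{std}$ of a sequence of subsets of $\mathbb{N}_0$ replaces its nonzero elements by $1,\ldots,n$ via the order-preserving bijection.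 The coproduct is the linear map with $\Delta(M_I)=\sum_{i=0}^kM_{\operatorname{std}(I_1,\ldots,I_i)}\otimes M_{\operatorname{std}(I_{i+1},\ldots,I_k)}$ (with $M_{()}=1$), into the super tensor product. Order: $J$ covers $I=(I_1,\ldots,I_k)$ if for some $i$, $I_i,I_{i+1}$ are non-fermionic, $\max I_i<\min I_{i+1}$, and $J=(I_1,\ldots,I_{i-1},I_i\cup I_{i+1},I_{i+2},\ldots,I_k)$; $\preceq$ is the reflexive-transitive closure. $Q_I=\sum_{J\succeq I}M_J$. A superpermutation is a set supercomposition all of whose non-fermionic blocks are singletons. -}

module Defs where

open import Data.Bool using (Bool; true; false; if_then_else_; not; _∧_; _∨_)
open import Data.Nat using (ℕ; zero; suc; _<_; _⊔_; _⊓_; _≡ᵇ_; _<ᵇ_)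
import Data.Nat.Properties as ℕP
open import Data.List using (List; []; _∷_; _++_; map; concat; concatMap; filterᵇ; length;
  take; drop; upTo; applyUpTo; zip; foldr; null; deduplicate)
open import Data.Bool.ListAction using (any)
import Data.List.Properties as LP
open import Data.List.Relation.Unary.All using (All)
open import Data.List.Relation.Unary.Linked using (Linked)
open import Data.List.Membership.Propositional using (_∈_; _∉_)
open import Data.List.Relation.Binary.Permutation.Propositional using (_↭_)
open import Data.Product using (_×_; _,_; proj₁; proj₂)
open import Data.Rational using (ℚ; 0ℚ; 1ℚ; _+_; _*_; -_)
open import Relation.Binary.PropositionalEquality using (_≡_; _≢_)
open import Relation.Binary using (DecidableEquality)
open import Relation.Nullary using (yes; no; does)

-- Finite sets of naturals are represented as strictly increasing lists.

Block : Set
Block = List ℕ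

memB : ℕ → Block → Bool
memB v = any (λ y → y ≡ᵇ v)

maxB : Block → ℕ
maxB = foldr _⊔_ 0

_∪ˢ_ : Block → Block → Block
B ∪ˢ C = filterᵇ (λ v → memB v B ∨ memB v C) (upTo (suc (maxB B ⊔ maxB C)))

minB : Block → ℕ
minB [] = 0
minB (x ∷ xs) = foldr _⊓_ x xs

isFerm : Block → Bool
isFerm = any (λ y → y ≡ᵇ 0)

-- (Raw) sequences of subsets; set supercompositions are those satisfying IsSSC

SSC : Set
SSC = List Block

_≟SSC_ : DecidableEquality SSC
_≟SSC_ = LP.≡-dec (LP.≡-dec ℕP._≟_)

nonzeros : SSC → List ℕ
nonzeros I = concat (map (filterᵇ (λ y → not (y ≡ᵇ 0))) I)

-- I is a set supercomposition (of bidegree (n,m) for n = length (nonzeros I)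
-- and m = number of blocks containing 0): blocks are nonempty subsets of ℕ
-- (strictly increasing lists), pairwise intersecting only in {0}, and the
-- nonzero elements form exactly [n].
IsSSC : SSC → Set
IsSSC I = All (λ B → (B ≢ []) × Linked _<_ B) I
        × (nonzeros I ↭ applyUpTo suc (length (nonzeros I)))

IsSuperperm : SSC → Set
IsSuperperm I = IsSSC I × All (λ B → 0 ∉ B → length B ≡ 1) I

std : SSC → SSC
std J = map (map f) J
  where
  nz = nonzeros J
  f : ℕ → ℕ
  f x = if x ≡ᵇ 0 then 0 else suc (length (filterᵇ (λ y → y <ᵇ x) nz))

mergeable : Block → Block → Bool
mergeable B C = not (isFerm B) ∧ not (isFerm C) ∧ (maxB B <ᵇ minB C)

covers : SSC → List SSC
covers [] = []
covers (B ∷ []) = []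
covers (B ∷ C ∷ rest) =
  (if mergeable B C then ((B ∪ˢ C) ∷ rest) ∷ [] else [])
  ++ map (B ∷_) (covers (C ∷ rest))

upF : ℕ → SSC → List SSC
upF zero I = I ∷ []
upF (suc k) I = I ∷ concatMap (upF k) (covers I)

-- { J : I ⪯ J }  (each cover step decreases the number of blocks, so
-- length I steps suffice), without repetitions
up : SSC → List SSC
up I = deduplicate _≟SSC_ (upF (length I) I)

-- Formal series in θ's and x's. A monomial in normal form
-- θ_{i1}⋯θ_{im} x_{j1}⋯x_{jn} is a pair (i-list, j-list) with the
-- i-list strictly increasing; variables are indexed by ℕ.

Mono : Set
Mono = List ℕ × List ℕ

NormalMono : Mono → Set
NormalMono (θs , ws) = Linked _<_ θs

Series : Set
Series = Mono → ℚ

sumℚ : List ℚ → ℚ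
sumℚ = foldr _+_ 0ℚ

blockOf : Mono → ℕ → Block
blockOf (θs , ws) v =
  (if any (λ y → y ≡ᵇ v) θs then 0 ∷ [] else [])
  ++ map proj₁ (filterᵇ (λ p → proj₂ p ≡ᵇ v) (zip (applyUpTo suc (length ws)) ws))

I[_] : Mono → SSC
I[ u@(θs , ws) ] =
  concatMap (λ v → if null (blockOf u v) then [] else blockOf u v ∷ [])
            (upTo (suc (foldr _⊔_ 0 (θs ++ ws))))

-- product of series: θ_A x_a · θ_B x_b = θ_A θ_B x_a x_b = ± θ_{A⊔B} x_{ab}
splits : List ℕ → List (List ℕ × List ℕ)
splits [] = ([] , []) ∷ []
splits (c ∷ cs) = concatMap (λ p → (c ∷ proj₁ p , proj₂ p) ∷ (proj₁ p , c ∷ proj₂ p) ∷ []) (splits cs)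

inversions : List ℕ → List ℕ → ℕ
inversions A B = foldr Data.Nat._+_ 0 (map (λ α → length (filterᵇ (λ β → β <ᵇ α) B)) A)

sgn : ℕ → ℚ
sgn zero = 1ℚ
sgn (suc k) = - sgn k

_⋆_ : Series → Series → Series
(f ⋆ g) (C , w) =
  sumℚ (map (λ i → sumℚ (map (λ p →
           sgn (inversions (proj₁ p) (proj₂ p)) * f (proj₁ p , take i w) * g (proj₂ p , drop i w))
         (splits C)))
       (upTo (suc (length w))))

oneS : Series
oneS ([] , []) = 1ℚ
oneS _ = 0ℚ

LinM : Set
LinM = List (ℚ × SSC)

M : SSC → Series
M I u = if does (I[ u ] ≟SSC I) then 1ℚ else 0ℚ

toSeries : LinM → Series
toSeries e u = sumℚ (map (λ p → proj₁ p * M (proj₂ p) u) e)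

Q : SSC → LinM
Q I = map (1ℚ ,_) (up I)

linQ : List (ℚ × SSC) → LinM
linQ = concatMap (λ p → map (λ q → proj₁ p * proj₁ q , proj₂ q) (Q (proj₂ p)))

-- Tensors: finite combinations Σ c M_K ⊗ M_L, compared by coefficients

LinM⊗ : Set
LinM⊗ = List (ℚ × SSC × SSC)

coef⊗ : LinM⊗ → SSC → SSC → ℚ
coef⊗ t K L = sumℚ (map (λ p → if does (proj₁ (proj₂ p) ≟SSC K) ∧ does (proj₂ (proj₂ p) ≟SSC L)
                                 then proj₁ p else 0ℚ) t)

Δ : LinM → LinM⊗
Δ e = concatMap (λ p → map (λ i → proj₁ p , std (take i (proj₂ p)) , std (drop i (proj₂ p)))
                           (upTo (suc (length (proj₂ p))))) e

linQ⊗ : List (ℚ × SSC × SSC) → LinM⊗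
linQ⊗ = concatMap (λ p → concatMap (λ K → map (λ L → proj₁ p , K , L) (up (proj₂ (proj₂ p))))
                                   (up (proj₁ (proj₂ p))))

AllSP : List (ℚ × SSC) → Set
AllSP r = All (λ p → IsSuperperm (proj₂ p)) r

AllSP⊗ : List (ℚ × SSC × SSC) → Set
AllSP⊗ r = All (λ p → IsSuperperm (proj₁ (proj₂ p)) × IsSuperperm (proj₂ (proj₂ p))) r

-- For a superpermutation I, the series Q_I is the indicator of the monomials u whose
-- superpermutation is I, where the superpermutation of u is I(u) with its non-fermionic
-- blocks split into singletons: J ⪰ I exactly when J is well formed and splitting J gives I.
-- So the span of the Q_I consists of the series whose coefficient at u depends only on the
-- superpermutation of u (with finite support in it), and the unit is Q_[].
-- In a product, the two factors of u = θ_C x_w are θ_A x_{w₁⋯wᵢ} and θ_B x_{wᵢ₊₁⋯}, and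
-- their superpermutations can be read off from that of u; hence the product again depends only
-- on the superpermutation of u, and only superpermutations of bounded bidegree occur.
-- For the coproduct, cutting each J ⪰ I at every position and standardizing the two pieces
-- is a bijection onto the triples (i, K, L) with K ⪰ std (I₁⋯Iᵢ) and L ⪰ std (Iᵢ₊₁⋯), so
-- Δ Q_I = Σᵢ Q_std(I₁⋯Iᵢ) ⊗ Q_std(Iᵢ₊₁⋯).

module Submission where

open import Defs
open import Data.Bool using (Bool; true; false; if_then_else_; not; _∧_; _∨_; T?)
open import Data.Bool.Properties using (∨-identityʳ; ∧-identityʳ; ∧-zeroʳ)
open import Data.Empty using (⊥-elim)
open import Data.List using (List; []; _∷_; _++_; map; concat; concatMap; filter; filterᵇ; length; take; drop; upTo; applyUpTo; foldr; null; zip; deduplicate)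
import Data.List.Membership.DecPropositional as DecMembership
open import Data.List.Membership.Propositional using (_∈_; _∉_; find; lose)
import Data.List.Membership.Propositional.Properties as ∈
import Data.List.Properties as List
open import Data.List.Relation.Binary.Permutation.Propositional using (_↭_; prep; ↭-refl; ↭-trans; ↭-sym; ↭-reflexive)
import Data.List.Relation.Binary.Permutation.Propositional as Perm
import Data.List.Relation.Binary.Permutation.Propositional.Properties as Perm
import Data.List.Relation.Binary.Permutation.Setoid.Properties as PermSetoid
open import Data.List.Relation.Unary.All using (All; []; _∷_)
import Data.List.Relation.Unary.All as All
import Data.List.Relation.Unary.All.Properties as All
open import Data.List.Relation.Unary.AllPairs using (AllPairs; []; _∷_)
import Data.List.Relation.Unary.AllPairs as AllPairs
import Data.List.Relation.Unary.AllPairs.Properties as AllPairs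
open import Data.List.Relation.Unary.Any using (here; there; any?)
open import Data.List.Relation.Unary.Linked using (Linked; []; [-]; _∷_; linked?)
import Data.List.Relation.Unary.Linked.Properties as Linked
open import Data.List.Relation.Unary.Unique.DecPropositional.Properties using (deduplicate-!)
open import Data.List.Relation.Unary.Unique.Propositional using (Unique)
import Data.List.Relation.Unary.Unique.Propositional.Properties as UniqueProp
import Data.List.Sort as Sort
open import Data.Nat using (ℕ; zero; suc; _+_; _∸_; _≤_; _<_; z≤n; s≤s; _⊔_; _⊓_; _≡ᵇ_; _<ᵇ_)
import Data.Nat.Properties as ℕ
open import Data.Product using (_×_; _,_; proj₁; proj₂; Σ)
open import Data.Rational using (ℚ; 0ℚ; 1ℚ)
import Data.Rational as ℚ
import Data.Rational.Properties as ℚ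
open import Data.Sum using (_⊎_; inj₁; inj₂)
open import Data.Unit using (tt)
open import Function.Base using (case_of_)
open import Function.Bundles using (_⇔_; mk⇔; Equivalence)
open import Relation.Binary.Construct.Closure.ReflexiveTransitive using (Star; ε; _◅_; _◅◅_; gmap)
open import Relation.Binary.Definitions using (DecidableEquality; tri<; tri≈; tri>)
open import Relation.Binary.PropositionalEquality
open import Relation.Nullary using (Dec; yes; no; does; ¬_; ¬?; _×-dec_; _→-dec_)
open import Relation.Nullary.Decidable using (dec-true; dec-false)

sumℚ-++ : ∀ (xs ys : List ℚ) → sumℚ (xs ++ ys) ≡ sumℚ xs ℚ.+ sumℚ ys
sumℚ-++ [] ys = sym (ℚ.+-identityˡ _)
sumℚ-++ (x ∷ xs) ys = trans (cong (x ℚ.+_) (sumℚ-++ xs ys)) (sym (ℚ.+-assoc x _ _))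

module _ {A : Set} where

  sumℚ-cong : ∀ {f g : A → ℚ} xs → (∀ {x} → x ∈ xs → f x ≡ g x) → sumℚ (map f xs) ≡ sumℚ (map g xs)
  sumℚ-cong [] _ = refl
  sumℚ-cong (x ∷ xs) f≡g = cong₂ ℚ._+_ (f≡g (here refl)) (sumℚ-cong xs (λ x∈ → f≡g (there x∈)))

  sumℚ-zero : ∀ {f : A → ℚ} xs → (∀ {x} → x ∈ xs → f x ≡ 0ℚ) → sumℚ (map f xs) ≡ 0ℚ
  sumℚ-zero [] _ = refl
  sumℚ-zero (x ∷ xs) f≡0 = trans (cong₂ ℚ._+_ (f≡0 (here refl)) (sumℚ-zero xs (λ x∈ → f≡0 (there x∈)))) (ℚ.+-identityˡ 0ℚ)

  sumℚ-single : ∀ {f : A → ℚ} {xs x₀} → Unique xs → x₀ ∈ xs →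
                (∀ {x} → x ∈ xs → x ≢ x₀ → f x ≡ 0ℚ) → sumℚ (map f xs) ≡ f x₀
  sumℚ-single {f} {y ∷ xs} (y∉ ∷ _) (here refl) f≡0 =
    trans (cong (f y ℚ.+_) (sumℚ-zero xs (λ x∈ → f≡0 (there x∈) (λ x≡y → All.lookup y∉ x∈ (sym x≡y)))))
          (ℚ.+-identityʳ _)
  sumℚ-single {f} {y ∷ xs} (y∉ ∷ u) (there x₀∈) f≡0 =
    trans (cong₂ ℚ._+_ (f≡0 (here refl) (All.lookup y∉ x₀∈)) (sumℚ-single u x₀∈ (λ x∈ → f≡0 (there x∈))))
          (ℚ.+-identityˡ _)

  sumℚ-concatMap : ∀ {B : Set} (f : B → ℚ) (g : A → List B) xs →
                   sumℚ (map f (concatMap g xs)) ≡ sumℚ (map (λ x → sumℚ (map f (g x))) xs)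
  sumℚ-concatMap f g [] = refl
  sumℚ-concatMap f g (x ∷ xs) =
    trans (cong sumℚ (List.map-++ f (g x) (concatMap g xs)))
          (trans (sumℚ-++ (map f (g x)) _) (cong (sumℚ (map f (g x)) ℚ.+_) (sumℚ-concatMap f g xs)))

  sumℚ-map-map : ∀ {B : Set} (f : B → ℚ) (g : A → B) xs → sumℚ (map f (map g xs)) ≡ sumℚ (map (λ x → f (g x)) xs)
  sumℚ-map-map f g xs = cong sumℚ (sym (List.map-∘ xs))

when : ∀ {P : Set} → Dec P → ℚ → ℚ
when P? c = if does P? then c else 0ℚ

module _ {P : Set} (P? : Dec P) (c : ℚ) where

  when-yes : P → when P? c ≡ c
  when-yes p = cong (λ b → if b then c else 0ℚ) (dec-true P? p)

  when-no : ¬ P → when P? c ≡ 0ℚ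
  when-no ¬p = cong (λ b → if b then c else 0ℚ) (dec-false P? ¬p)

  scale-when : (c ℚ.* 1ℚ) ℚ.* when P? 1ℚ ≡ when P? c
  scale-when with does P?
  ... | true = trans (ℚ.*-identityʳ _) (ℚ.*-identityʳ c)
  ... | false = ℚ.*-zeroʳ (c ℚ.* 1ℚ)

when-⇔ : ∀ {P Q : Set} (P? : Dec P) (Q? : Dec Q) c → P ⇔ Q → when P? c ≡ when Q? c
when-⇔ P? Q? c P⇔Q with P? | Q?
... | yes _ | yes _ = refl
... | no _ | no _ = refl
... | yes p | no ¬q = ⊥-elim (¬q (Equivalence.to P⇔Q p))
... | no ¬p | yes q = ⊥-elim (¬p (Equivalence.from P⇔Q q))

module _ {A : Set} (_≟_ : DecidableEquality A) where
  open DecMembership _≟_ using (_∈?_)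

  sumℚ-indicator : ∀ {xs} (f : A → ℚ) y → Unique xs → sumℚ (map (λ x → when (y ≟ x) (f x)) xs) ≡ when (y ∈? xs) (f y)
  sumℚ-indicator {xs} f y xs-unique with y ∈? xs
  ... | yes y∈ = trans (sumℚ-single xs-unique y∈ (λ _ x≢y → when-no (y ≟ _) _ (λ y≡x → x≢y (sym y≡x))))
                       (when-yes (y ≟ y) (f y) refl)
  ... | no y∉ = sumℚ-zero xs (λ x∈ → when-no (y ≟ _) _ (λ { refl → y∉ x∈ }))

≡ᵇ-refl : ∀ n → (n ≡ᵇ n) ≡ true
≡ᵇ-refl zero = refl
≡ᵇ-refl (suc n) = ≡ᵇ-refl n

≡ᵇ-≢ : ∀ {m n} → m ≢ n → (m ≡ᵇ n) ≡ false
≡ᵇ-≢ {zero} {zero} m≢n = ⊥-elim (m≢n refl)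
≡ᵇ-≢ {zero} {suc n} _ = refl
≡ᵇ-≢ {suc m} {zero} _ = refl
≡ᵇ-≢ {suc m} {suc n} m≢n = ≡ᵇ-≢ (λ m≡n → m≢n (cong suc m≡n))

≡ᵇ-sound : ∀ {m n} → (m ≡ᵇ n) ≡ true → m ≡ n
≡ᵇ-sound {zero} {zero} _ = refl
≡ᵇ-sound {suc m} {suc n} eq = cong suc (≡ᵇ-sound eq)

<ᵇ-< : ∀ {m n} → m < n → (m <ᵇ n) ≡ true
<ᵇ-< {zero} {suc n} _ = refl
<ᵇ-< {suc m} {suc n} (s≤s m<n) = <ᵇ-< m<n

<ᵇ-≥ : ∀ {m n} → n ≤ m → (m <ᵇ n) ≡ false
<ᵇ-≥ {m} {zero} _ = refl
<ᵇ-≥ {suc m} {suc n} (s≤s n≤m) = <ᵇ-≥ n≤m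

<ᵇ⇒< : ∀ {m n} → (m <ᵇ n) ≡ true → m < n
<ᵇ⇒< {zero} {suc n} _ = s≤s z≤n
<ᵇ⇒< {suc m} {suc n} eq = s≤s (<ᵇ⇒< eq)

<ᵇ⇒≥ : ∀ {m n} → (m <ᵇ n) ≡ false → n ≤ m
<ᵇ⇒≥ {m} {zero} _ = z≤n
<ᵇ⇒≥ {suc m} {suc n} eq = s≤s (<ᵇ⇒≥ eq)

Increasing : List ℕ → Set
Increasing = AllPairs _<_

Linked⇒Increasing : ∀ {xs} → Linked _<_ xs → Increasing xs
Linked⇒Increasing = Linked.Linked⇒AllPairs ℕ.<-trans

memB-++ : ∀ v xs ys → memB v (xs ++ ys) ≡ (memB v xs ∨ memB v ys)
memB-++ v [] ys = refl
memB-++ v (x ∷ xs) ys with x ≡ᵇ v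
... | true = refl
... | false = memB-++ v xs ys

memB-∉ : ∀ {v xs} → All (_≢ v) xs → memB v xs ≡ false
memB-∉ [] = refl
memB-∉ (x≢v ∷ xs≢v) rewrite ≡ᵇ-≢ x≢v = memB-∉ xs≢v

memB-∈ : ∀ {v xs} → v ∈ xs → memB v xs ≡ true
memB-∈ {v} (here refl) rewrite ≡ᵇ-refl v = refl
memB-∈ {v} {x ∷ xs} (there v∈) with x ≡ᵇ v
... | true = refl
... | false = memB-∈ v∈

memB-sound : ∀ {v} xs → memB v xs ≡ true → v ∈ xs
memB-sound {v} (x ∷ xs) eq with x ≡ᵇ v in x≡v
... | true = here (sym (≡ᵇ-sound x≡v))
... | false = there (memB-sound xs eq)

memB-false⇒∉ : ∀ {v} xs → memB v xs ≡ false → v ∉ xs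
memB-false⇒∉ xs eq v∈ with () ← trans (sym (memB-∈ v∈)) eq

memB-filter : ∀ (a : ℕ → Bool) v xs → memB v (filterᵇ a xs) ≡ (a v ∧ memB v xs)
memB-filter a v [] with a v
... | true = refl
... | false = refl
memB-filter a v (x ∷ xs) with a x in ax | x ℕ.≟ v
... | true | yes refl rewrite ≡ᵇ-refl x | ax = refl
... | true | no x≢v rewrite ≡ᵇ-≢ x≢v = memB-filter a v xs
... | false | yes refl rewrite ax = trans (memB-filter a x xs) (cong (_∧ memB x xs) ax)
... | false | no x≢v rewrite ≡ᵇ-≢ x≢v = memB-filter a v xs

filter-increasing : ∀ (p : ℕ → Bool) {xs S} → Increasing xs → Increasing S → All (_∈ xs) S →
                    (∀ {v} → v ∈ xs → p v ≡ memB v S) → filterᵇ p xs ≡ S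
filter-increasing p {[]} {[]} _ _ _ _ = refl
filter-increasing p {[]} {s ∷ S} _ _ (() ∷ _) _
filter-increasing p {x ∷ xs} {[]} (_ ∷ xs↑) _ _ p≡ rewrite p≡ (here refl) =
  filter-increasing p xs↑ [] [] (λ v∈ → p≡ (there v∈))
filter-increasing p {x ∷ xs} {s ∷ S} (x< ∷ xs↑) (s< ∷ S↑) (s∈ ∷ S⊆) p≡ with s ℕ.≟ x
... | yes refl rewrite p≡ (here refl) | ≡ᵇ-refl s =
  cong (s ∷_) (filter-increasing p xs↑ S↑ (All.zipWith tail (s< , S⊆)) p≡tail)
  where
  tail : ∀ {t} → s < t × t ∈ s ∷ xs → t ∈ xs
  tail (s<t , here refl) = ⊥-elim (ℕ.<-irrefl refl s<t)
  tail (_ , there t∈) = t∈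
  p≡tail : ∀ {v} → v ∈ xs → p v ≡ memB v S
  p≡tail v∈ rewrite p≡ (there v∈) | ≡ᵇ-≢ (ℕ.<⇒≢ (All.lookup x< v∈)) = refl
... | no s≢x with s∈
...   | here s≡x = ⊥-elim (s≢x s≡x)
...   | there s∈xs rewrite p≡ (here refl) | ≡ᵇ-≢ s≢x
                   | memB-∉ {x} {S} (All.map (λ s<t t≡x → ℕ.<-asym (All.lookup x< s∈xs) (subst (s <_) t≡x s<t)) s<) =
  filter-increasing p xs↑ (s< ∷ S↑) (s∈xs ∷ All.zipWith tail (All.map (ℕ.<-trans (All.lookup x< s∈xs)) s< , S⊆))
    (λ v∈ → p≡ (there v∈))
  where
  tail : ∀ {t} → x < t × t ∈ x ∷ xs → t ∈ xs
  tail (x<t , here refl) = ⊥-elim (ℕ.<-irrefl refl x<t)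
  tail (_ , there t∈) = t∈

upTo-increasing : ∀ n → Increasing (upTo n)
upTo-increasing n = AllPairs.applyUpTo⁺₁ (λ i → i) n (λ i<j _ → i<j)

filter-upTo : ∀ (p : ℕ → Bool) {b S} → Increasing S → All (_< b) S →
              (∀ {v} → v < b → p v ≡ memB v S) → filterᵇ p (upTo b) ≡ S
filter-upTo p {b} S↑ S<b p≡ =
  filter-increasing p (upTo-increasing b) S↑ (All.map ∈.∈-upTo⁺ S<b) (λ v∈ → p≡ (∈.∈-upTo⁻ v∈))

module _ {A B : Set} where

  concatMap-concatMap : ∀ {C : Set} (f : B → List C) (g : A → List B) xs →
                        concatMap f (concatMap g xs) ≡ concatMap (λ x → concatMap f (g x)) xs
  concatMap-concatMap f g [] = refl
  concatMap-concatMap f g (x ∷ xs) =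
    trans (List.concatMap-++ f (g x) _) (cong (concatMap f (g x) ++_) (concatMap-concatMap f g xs))

  All-concatMap : ∀ {P : B → Set} (f : A → List B) xs → (∀ {x} → x ∈ xs → All P (f x)) → All P (concatMap f xs)
  All-concatMap f xs Pf = All.concat⁺ (All.map⁺ (All.tabulate Pf))

  concatMap-[] : ∀ {f : A → List B} {xs} → All (λ x → f x ≡ []) xs → concatMap f xs ≡ []
  concatMap-[] [] = refl
  concatMap-[] (fx≡[] ∷ fxs≡[]) rewrite fx≡[] = concatMap-[] fxs≡[]

  concatMap-if : ∀ (p : A → Bool) (f : A → B) xs →
                 concatMap (λ x → if p x then f x ∷ [] else []) xs ≡ map f (filterᵇ p xs)
  concatMap-if p f [] = refl
  concatMap-if p f (x ∷ xs) with p x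
  ... | true = cong (f x ∷_) (concatMap-if p f xs)
  ... | false = concatMap-if p f xs

  filter-concatMap : ∀ (p : B → Bool) (g : A → List B) xs →
                     filterᵇ p (concatMap g xs) ≡ concatMap (λ x → filterᵇ p (g x)) xs
  filter-concatMap p g [] = refl
  filter-concatMap p g (x ∷ xs) =
    trans (List.filter-++ (λ y → T? (p y)) (g x) _) (cong (filterᵇ p (g x) ++_) (filter-concatMap p g xs))

module _ {A : Set} where

  filterᵇ-none : ∀ (p : A → Bool) {xs} → All (λ x → p x ≡ false) xs → filterᵇ p xs ≡ []
  filterᵇ-none p [] = refl
  filterᵇ-none p (px ∷ pxs) rewrite px = filterᵇ-none p pxs

  filterᵇ-accept : ∀ {p : A → Bool} {x} xs → p x ≡ true → filterᵇ p (x ∷ xs) ≡ x ∷ filterᵇ p xs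
  filterᵇ-accept _ px rewrite px = refl

  filterᵇ-reject : ∀ {p : A → Bool} {x} xs → p x ≡ false → filterᵇ p (x ∷ xs) ≡ filterᵇ p xs
  filterᵇ-reject _ px rewrite px = refl

  filterᵇ-cong-local : ∀ {p q : A → Bool} {xs} → All (λ x → p x ≡ q x) xs → filterᵇ p xs ≡ filterᵇ q xs
  filterᵇ-cong-local [] = refl
  filterᵇ-cong-local {p} {q} {x ∷ xs} (px≡qx ∷ pxs≡qxs) with p x | q x
  ... | true | true = cong (x ∷_) (filterᵇ-cong-local pxs≡qxs)
  ... | false | false = filterᵇ-cong-local pxs≡qxs

  applyUpTo-cong : ∀ {f g : ℕ → A} → (∀ j → f j ≡ g j) → ∀ n → applyUpTo f n ≡ applyUpTo g n
  applyUpTo-cong f≡g zero = refl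
  applyUpTo-cong f≡g (suc n) = cong₂ _∷_ (f≡g 0) (applyUpTo-cong (λ j → f≡g (suc j)) n)

concatMap-++-↭ : ∀ {A : Set} (f g : A → List ℕ) xs → concatMap (λ x → f x ++ g x) xs ↭ concatMap f xs ++ concatMap g xs
concatMap-++-↭ f g [] = ↭-refl
concatMap-++-↭ f g (x ∷ xs) = begin
  (f x ++ g x) ++ concatMap (λ x → f x ++ g x) xs  ↭⟨ Perm.++⁺ˡ (f x ++ g x) (concatMap-++-↭ f g xs) ⟩
  (f x ++ g x) ++ (concatMap f xs ++ concatMap g xs) ≡⟨ List.++-assoc (f x) (g x) _ ⟩
  f x ++ (g x ++ concatMap f xs ++ concatMap g xs)   ↭⟨ Perm.++⁺ˡ (f x) (Perm.shifts (g x) (concatMap f xs)) ⟩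
  f x ++ (concatMap f xs ++ g x ++ concatMap g xs)   ≡⟨ List.++-assoc (f x) (concatMap f xs) _ ⟨
  (f x ++ concatMap f xs) ++ (g x ++ concatMap g xs)  ∎
  where open Perm.PermutationReasoning

-- Splitting blocks, and the superpermutation of a monomial

WellFormed : SSC → Set
WellFormed J = All (λ B → B ≢ [] × Increasing B) J

Positive : List ℕ → Set
Positive = All (0 <_)

singletons : List ℕ → SSC
singletons = map (_∷ [])

splitBlock : Block → SSC
splitBlock B = if isFerm B then B ∷ [] else singletons B

splitBlocks : SSC → SSC
splitBlocks = concatMap splitBlock

blockNonzeros : Block → List ℕ
blockNonzeros = filterᵇ (λ y → not (y ≡ᵇ 0))

xDegree : SSC → ℕ
xDegree K = length (nonzeros K)

θDegree : SSC → ℕ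
θDegree K = length (filterᵇ isFerm K)

SuperpermBlock : Block → Set
SuperpermBlock B = (B ≢ [] × Linked _<_ B) × (0 ∉ B → length B ≡ 1)

splitBlock-superpermBlocks : ∀ {B} → Increasing B → All SuperpermBlock (splitBlock B)
splitBlock-superpermBlocks {B} B↑ with isFerm B in θ
... | true = ((nonempty , Linked.AllPairs⇒Linked B↑) , (λ 0∉B → ⊥-elim (0∉B (memB-sound B θ)))) ∷ []
  where
  nonempty : B ≢ []
  nonempty B≡[] with () ← trans (sym (cong isFerm B≡[])) θ
... | false = All.map⁺ (All.tabulate (λ _ → ((λ ()) , [-]) , (λ _ → refl)))

isFerm-positive : ∀ {P} → Positive P → isFerm P ≡ false
isFerm-positive [] = refl
isFerm-positive {suc _ ∷ _} (_ ∷ P>0) = isFerm-positive P>0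

blockNonzeros-id : ∀ {P} → Positive P → blockNonzeros P ≡ P
blockNonzeros-id [] = refl
blockNonzeros-id {suc t ∷ _} (_ ∷ P>0) = cong (suc t ∷_) (blockNonzeros-id P>0)

positive-blockNonzeros : ∀ B → Positive (blockNonzeros B)
positive-blockNonzeros [] = []
positive-blockNonzeros (zero ∷ B) = positive-blockNonzeros B
positive-blockNonzeros (suc t ∷ B) = s≤s z≤n ∷ positive-blockNonzeros B

splitBlock-positive : ∀ {P} → Positive P → splitBlock P ≡ singletons P
splitBlock-positive P>0 rewrite isFerm-positive P>0 = refl

splitBlock-++ : ∀ B C → isFerm B ≡ false → isFerm C ≡ false → splitBlock (B ++ C) ≡ splitBlock B ++ splitBlock C
splitBlock-++ B C B≢θ C≢θ rewrite memB-++ 0 B C | B≢θ | C≢θ = List.map-++ (_∷ []) B C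

splitBlocks-++ : ∀ X Y → splitBlocks (X ++ Y) ≡ splitBlocks X ++ splitBlocks Y
splitBlocks-++ = List.concatMap-++ splitBlock

nonzeros-singletons : ∀ B → nonzeros (singletons B) ≡ blockNonzeros B
nonzeros-singletons [] = refl
nonzeros-singletons (zero ∷ B) = nonzeros-singletons B
nonzeros-singletons (suc t ∷ B) = cong (suc t ∷_) (nonzeros-singletons B)

nonzeros-splitBlock : ∀ B → nonzeros (splitBlock B) ≡ blockNonzeros B
nonzeros-splitBlock B with isFerm B
... | true = List.++-identityʳ _
... | false = nonzeros-singletons B

nonzeros-splitBlocks : ∀ X → nonzeros (splitBlocks X) ≡ nonzeros X
nonzeros-splitBlocks X =
  trans (concatMap-concatMap blockNonzeros splitBlock X) (List.concatMap-cong nonzeros-splitBlock X)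

concat-splitBlock : ∀ B → concat (splitBlock B) ≡ B
concat-splitBlock B with isFerm B
... | true = List.++-identityʳ B
... | false = List.concat-map-[ B ]

concat-splitBlocks : ∀ X → concat (splitBlocks X) ≡ concat X
concat-splitBlocks [] = refl
concat-splitBlocks (B ∷ X) =
  trans (sym (List.concat-++ (splitBlock B) (splitBlocks X))) (cong₂ _++_ (concat-splitBlock B) (concat-splitBlocks X))

offsets : ℕ → ℕ → List ℕ
offsets k n = applyUpTo (λ j → suc (k + j)) n

offsets-suc : ∀ k n → offsets k (suc n) ≡ suc k ∷ offsets (suc k) n
offsets-suc k n = cong₂ _∷_ (cong suc (ℕ.+-identityʳ k)) (applyUpTo-cong (λ j → cong suc (ℕ.+-suc k j)) n)

-- The positions, numbered from k + 1, at which the letter v occurs in w.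
positions : ℕ → List ℕ → ℕ → List ℕ
positions k [] v = []
positions k (a ∷ w) v = if a ≡ᵇ v then suc k ∷ positions (suc k) w v else positions (suc k) w v

positions-zip : ∀ k w v →
  map proj₁ (filterᵇ (λ p → proj₂ p ≡ᵇ v) (zip (offsets k (length w)) w)) ≡ positions k w v
positions-zip k [] v = refl
positions-zip k (a ∷ w) v =
  trans (cong (λ ns → map proj₁ (filterᵇ (λ p → proj₂ p ≡ᵇ v) (zip ns (a ∷ w)))) (offsets-suc k (length w))) step
  where
  step : map proj₁ (filterᵇ (λ p → proj₂ p ≡ᵇ v) ((suc k , a) ∷ zip (offsets (suc k) (length w)) w))
         ≡ positions k (a ∷ w) v
  step with a ≡ᵇ v
  ... | true = cong (suc k ∷_) (positions-zip (suc k) w v)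
  ... | false = positions-zip (suc k) w v

positions-> : ∀ k w v → All (k <_) (positions k w v)
positions-> k [] v = []
positions-> k (a ∷ w) v with a ≡ᵇ v
... | true = ℕ.≤-refl ∷ All.map (ℕ.<-trans (ℕ.n<1+n k)) (positions-> (suc k) w v)
... | false = All.map (ℕ.<-trans (ℕ.n<1+n k)) (positions-> (suc k) w v)

positions-positive : ∀ w v → Positive (positions 0 w v)
positions-positive = positions-> 0

positions-increasing : ∀ k w v → Increasing (positions k w v)
positions-increasing k [] v = []
positions-increasing k (a ∷ w) v with a ≡ᵇ v
... | true = positions-> (suc k) w v ∷ positions-increasing (suc k) w v
... | false = positions-increasing (suc k) w v

positions-∉ : ∀ k {w v} → All (_≢ v) w → positions k w v ≡ []
positions-∉ k [] = refl
positions-∉ k (a≢v ∷ w≢v) rewrite ≡ᵇ-≢ a≢v = positions-∉ (suc k) w≢v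

positions-∷ : ∀ k a w v → positions k (a ∷ w) v ≡ (if a ≡ᵇ v then suc k ∷ [] else []) ++ positions (suc k) w v
positions-∷ k a w v with a ≡ᵇ v
... | true = refl
... | false = refl

concatMap-positions : ∀ k {w b} → All (_< b) w → concatMap (positions k w) (upTo b) ↭ offsets k (length w)
concatMap-positions k {[]} {b} [] = ↭-reflexive (concatMap-[] {xs = upTo b} (All.tabulate (λ _ → refl)))
concatMap-positions k {a ∷ w} {b} (a<b ∷ w<b) = begin
  concatMap (positions k (a ∷ w)) (upTo b)
    ≡⟨ List.concatMap-cong (positions-∷ k a w) (upTo b) ⟩
  concatMap (λ v → (if a ≡ᵇ v then suc k ∷ [] else []) ++ positions (suc k) w v) (upTo b)
    ↭⟨ concatMap-++-↭ _ (positions (suc k) w) (upTo b) ⟩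
  concatMap (λ v → if a ≡ᵇ v then suc k ∷ [] else []) (upTo b) ++ concatMap (positions (suc k) w) (upTo b)
    ≡⟨ cong (_++ concatMap (positions (suc k) w) (upTo b)) only-a ⟩
  suc k ∷ concatMap (positions (suc k) w) (upTo b)
    ↭⟨ prep (suc k) (concatMap-positions (suc k) w<b) ⟩
  suc k ∷ offsets (suc k) (length w)
    ≡⟨ offsets-suc k (length w) ⟨
  offsets k (suc (length w)) ∎
  where
  open Perm.PermutationReasoning
  only-a : concatMap (λ v → if a ≡ᵇ v then suc k ∷ [] else []) (upTo b) ≡ suc k ∷ []
  only-a = trans (concatMap-if (a ≡ᵇ_) (λ _ → suc k) (upTo b))
                 (cong (map (λ _ → suc k)) (filter-upTo (a ≡ᵇ_) ([] ∷ []) (a<b ∷ []) (λ _ → sym (∨-identityʳ _))))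

block : List ℕ → List ℕ → ℕ → Block
block C w v = (if memB v C then 0 ∷ [] else []) ++ positions 0 w v

blockOf≡block : ∀ C w v → blockOf (C , w) v ≡ block C w v
blockOf≡block C w v = cong ((if memB v C then 0 ∷ [] else []) ++_) (positions-zip 0 w v)

module _ {C : List ℕ} (w : List ℕ) (v : ℕ) where

  block-θ : memB v C ≡ true → block C w v ≡ 0 ∷ positions 0 w v
  block-θ v∈C rewrite v∈C = refl

  block-x : memB v C ≡ false → block C w v ≡ positions 0 w v
  block-x v∉C rewrite v∉C = refl

  splitBlock-block-θ : memB v C ≡ true → splitBlock (block C w v) ≡ (0 ∷ positions 0 w v) ∷ []
  splitBlock-block-θ v∈C = cong splitBlock (block-θ v∈C)

  splitBlock-block-x : memB v C ≡ false → splitBlock (block C w v) ≡ singletons (positions 0 w v)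
  splitBlock-block-x v∉C = trans (cong splitBlock (block-x v∉C)) (splitBlock-positive (positions-positive w v))

  blockNonzeros-block : blockNonzeros (block C w v) ≡ positions 0 w v
  blockNonzeros-block with memB v C
  ... | true = blockNonzeros-id (positions-positive w v)
  ... | false = blockNonzeros-id (positions-positive w v)

  nonzeros-splitBlock-block : nonzeros (splitBlock (block C w v)) ≡ positions 0 w v
  nonzeros-splitBlock-block = trans (nonzeros-splitBlock (block C w v)) blockNonzeros-block

  block-increasing : Increasing (block C w v)
  block-increasing with memB v C
  ... | true = positions-positive w v ∷ positions-increasing 0 w v
  ... | false = positions-increasing 0 w v

VarsBelow : ℕ → Mono → Set
VarsBelow b (C , w) = All (_< b) C × All (_< b) w

maxVar : Mono → ℕ
maxVar (C , w) = foldr _⊔_ 0 (C ++ w)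

foldr-⊔-≥ : ∀ xs → All (_≤ foldr _⊔_ 0 xs) xs
foldr-⊔-≥ [] = []
foldr-⊔-≥ (x ∷ xs) = ℕ.m≤m⊔n x _ ∷ All.map (λ y≤ → ℕ.≤-trans y≤ (ℕ.m≤n⊔m x _)) (foldr-⊔-≥ xs)

VarsBelow-maxVar : ∀ u → VarsBelow (suc (maxVar u)) u
VarsBelow-maxVar (C , w) = All.++⁻ C (All.map s≤s (foldr-⊔-≥ (C ++ w)))

block-≥ : ∀ {b C w v} → VarsBelow b (C , w) → b ≤ v → block C w v ≡ []
block-≥ {v = v} (C<b , w<b) b≤v
  rewrite memB-∉ {v} (All.map (λ t<b t≡v → ℕ.<-irrefl t≡v (ℕ.<-≤-trans t<b b≤v)) C<b)
  = positions-∉ 0 (All.map (λ t<b t≡v → ℕ.<-irrefl t≡v (ℕ.<-≤-trans t<b b≤v)) w<b)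

-- The unique superpermutation below I(u).
superpermOf : Mono → SSC
superpermOf u = splitBlocks I[ u ]

superpermBelow : ℕ → Mono → SSC
superpermBelow b (C , w) = concatMap (λ v → splitBlock (block C w v)) (upTo b)

superpermOf≡superpermBelow-max : ∀ u → superpermOf u ≡ superpermBelow (suc (maxVar u)) u
superpermOf≡superpermBelow-max u@(C , w) =
  trans (concatMap-concatMap splitBlock (λ v → if null (blockOf u v) then [] else blockOf u v ∷ []) (upTo (suc (maxVar u))))
        (List.concatMap-cong (λ v → trans (drop-null (blockOf u v)) (cong splitBlock (blockOf≡block C w v))) (upTo (suc (maxVar u))))
  where
  drop-null : ∀ B → splitBlocks (if null B then [] else B ∷ []) ≡ splitBlock B
  drop-null [] = refl
  drop-null (_ ∷ _) = List.++-identityʳ _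

superpermBelow-+ : ∀ {b} d u → VarsBelow b u → superpermBelow (b + d) u ≡ superpermBelow b u
superpermBelow-+ {b} zero u _ rewrite ℕ.+-identityʳ b = refl
superpermBelow-+ {b} (suc d) u@(C , w) vb rewrite ℕ.+-suc b d = begin
  concatMap f (upTo (suc (b + d)))              ≡⟨ cong (concatMap f) (List.upTo-∷ʳ (b + d)) ⟨
  concatMap f (upTo (b + d) ++ (b + d) ∷ [])    ≡⟨ List.concatMap-++ f (upTo (b + d)) _ ⟩
  concatMap f (upTo (b + d)) ++ f (b + d) ++ [] ≡⟨ cong (λ B → concatMap f (upTo (b + d)) ++ splitBlock B ++ []) (block-≥ vb (ℕ.m≤m+n b d)) ⟩
  concatMap f (upTo (b + d)) ++ []              ≡⟨ List.++-identityʳ _ ⟩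
  superpermBelow (b + d) u                      ≡⟨ superpermBelow-+ d u vb ⟩
  superpermBelow b u                            ∎
  where
  open ≡-Reasoning
  f = λ v → splitBlock (block C w v)

superpermOf≡superpermBelow : ∀ {b} u → VarsBelow b u → superpermOf u ≡ superpermBelow b u
superpermOf≡superpermBelow {b} u vb with ℕ.≤-total (suc (maxVar u)) b
... | inj₁ max<b = trans (superpermOf≡superpermBelow-max u)
  (sym (trans (cong (λ c → superpermBelow c u) (sym (ℕ.m+[n∸m]≡n max<b))) (superpermBelow-+ _ u (VarsBelow-maxVar u))))
... | inj₂ b≤max = trans (superpermOf≡superpermBelow-max u)
  (trans (cong (λ c → superpermBelow c u) (sym (ℕ.m+[n∸m]≡n b≤max))) (superpermBelow-+ _ u vb))

nonzeros-superpermBelow : ∀ {b C w} → VarsBelow b (C , w) → nonzeros (superpermBelow b (C , w)) ↭ applyUpTo suc (length w)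
nonzeros-superpermBelow {b} {C} {w} (_ , w<b) = begin
  nonzeros (superpermBelow b (C , w))
    ≡⟨ concatMap-concatMap blockNonzeros (λ v → splitBlock (block C w v)) (upTo b) ⟩
  concatMap (λ v → nonzeros (splitBlock (block C w v))) (upTo b)
    ≡⟨ List.concatMap-cong (nonzeros-splitBlock-block {C} w) (upTo b) ⟩
  concatMap (positions 0 w) (upTo b)
    ↭⟨ concatMap-positions 0 w<b ⟩
  applyUpTo suc (length w) ∎
  where open Perm.PermutationReasoning

nonzeros-superpermOf : ∀ u → nonzeros (superpermOf u) ↭ applyUpTo suc (length (proj₂ u))
nonzeros-superpermOf u = subst (λ K → nonzeros K ↭ applyUpTo suc (length (proj₂ u)))
  (sym (superpermOf≡superpermBelow-max u)) (nonzeros-superpermBelow (VarsBelow-maxVar u))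

xDegree-superpermOf : ∀ u → xDegree (superpermOf u) ≡ length (proj₂ u)
xDegree-superpermOf u = trans (Perm.↭-length (nonzeros-superpermOf u)) (List.length-applyUpTo suc _)

θDegree-superpermBelow : ∀ {b C} w → Increasing C → VarsBelow b (C , w) → θDegree (superpermBelow b (C , w)) ≡ length C
θDegree-superpermBelow {b} {C} w C↑ (C<b , _) = begin
  length (filterᵇ isFerm (concatMap (λ v → splitBlock (block C w v)) (upTo b)))
    ≡⟨ cong length (filter-concatMap isFerm (λ v → splitBlock (block C w v)) (upTo b)) ⟩
  length (concatMap (λ v → filterᵇ isFerm (splitBlock (block C w v))) (upTo b))
    ≡⟨ cong length (List.concatMap-cong fermionic-part (upTo b)) ⟩
  length (concatMap (λ v → if memB v C then block C w v ∷ [] else []) (upTo b))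
    ≡⟨ cong length (concatMap-if (λ v → memB v C) (block C w) (upTo b)) ⟩
  length (map (block C w) (filterᵇ (λ v → memB v C) (upTo b)))
    ≡⟨ List.length-map (block C w) (filterᵇ (λ v → memB v C) (upTo b)) ⟩
  length (filterᵇ (λ v → memB v C) (upTo b))
    ≡⟨ cong length (filter-upTo (λ v → memB v C) C↑ C<b (λ _ → refl)) ⟩
  length C ∎
  where
  open ≡-Reasoning
  fermionic-part : ∀ v → filterᵇ isFerm (splitBlock (block C w v)) ≡ (if memB v C then block C w v ∷ [] else [])
  fermionic-part v with memB v C
  ... | true = refl
  ... | false = trans (cong (filterᵇ isFerm) (splitBlock-positive (positions-positive w v)))
    (filterᵇ-none isFerm (All.map⁺ (All.map (λ { {suc _} _ → refl }) (positions-positive w v))))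

θDegree-superpermOf : ∀ C w → Increasing C → θDegree (superpermOf (C , w)) ≡ length C
θDegree-superpermOf C w C↑ =
  trans (cong θDegree (superpermOf≡superpermBelow-max (C , w))) (θDegree-superpermBelow w C↑ (VarsBelow-maxVar (C , w)))

superpermOf-isSuperperm : ∀ u → IsSuperperm (superpermOf u)
superpermOf-isSuperperm u@(C , w) = (All.map proj₁ blocks , nonzeros↭) , All.map proj₂ blocks
  where
  blocks : All SuperpermBlock (superpermOf u)
  blocks = subst (All SuperpermBlock) (sym (superpermOf≡superpermBelow-max u))
    (All-concatMap (λ v → splitBlock (block C w v)) (upTo (suc (maxVar u)))
                   (λ {v} _ → splitBlock-superpermBlocks (block-increasing {C} w v)))
  nonzeros↭ : nonzeros (superpermOf u) ↭ applyUpTo suc (xDegree (superpermOf u))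
  nonzeros↭ = subst (λ n → nonzeros (superpermOf u) ↭ applyUpTo suc n) (sym (xDegree-superpermOf u)) (nonzeros-superpermOf u)

I[]-wellFormed : ∀ u → WellFormed I[ u ]
I[]-wellFormed u@(C , w) = All-concatMap _ (upTo (suc (maxVar u))) (λ {v} _ → nonempty-block v)
  where
  nonempty-block : ∀ v → All (λ B → B ≢ [] × Increasing B) (if null (blockOf u v) then [] else blockOf u v ∷ [])
  nonempty-block v with blockOf u v | blockOf≡block C w v
  ... | [] | _ = []
  ... | _ ∷ _ | B≡ = ((λ ()) , subst Increasing (sym B≡) (block-increasing {C} w v)) ∷ []

-- The order ⪯

minB-increasing : ∀ {x xs} → Increasing (x ∷ xs) → minB (x ∷ xs) ≡ x
minB-increasing {x} {[]} _ = refl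
minB-increasing {x} {y ∷ ys} ((x<y ∷ x<ys) ∷ (_ ∷ ys↑)) =
  trans (cong (y ⊓_) (minB-increasing (x<ys ∷ ys↑))) (ℕ.m≥n⇒m⊓n≡n (ℕ.<⇒≤ x<y))

minB-≤ : ∀ {C} → Increasing C → All (minB C ≤_) C
minB-≤ [] = []
minB-≤ C↑@(x< ∷ _) rewrite minB-increasing C↑ = ℕ.≤-refl ∷ All.map ℕ.<⇒≤ x<

++-increasing : ∀ {B C} → Increasing B → Increasing C → maxB B < minB C → Increasing (B ++ C)
++-increasing {B} {C} B↑ C↑ max<min =
  AllPairs.++⁺ B↑ C↑ (All.map (λ b≤ → All.map (λ ≤c → ℕ.≤-<-trans b≤ (ℕ.<-≤-trans max<min ≤c)) (minB-≤ C↑)) (foldr-⊔-≥ B))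

∪ˢ-separated : ∀ {B C} → Increasing B → Increasing C → maxB B < minB C → B ∪ˢ C ≡ B ++ C
∪ˢ-separated {B} {C} B↑ C↑ max<min =
  filter-upTo (λ v → memB v B ∨ memB v C) (++-increasing B↑ C↑ max<min)
    (All.++⁺ (All.map (λ b≤ → s≤s (ℕ.≤-trans b≤ (ℕ.m≤m⊔n _ _))) (foldr-⊔-≥ B))
             (All.map (λ c≤ → s≤s (ℕ.≤-trans c≤ (ℕ.m≤n⊔m _ _))) (foldr-⊔-≥ C)))
    (λ {v} _ → sym (memB-++ v B C))

mergeable-sound : ∀ B C → mergeable B C ≡ true → isFerm B ≡ false × isFerm C ≡ false × maxB B < minB C
mergeable-sound B C m with isFerm B | isFerm C | maxB B <ᵇ minB C in lt
... | false | false | true = refl , refl , <ᵇ⇒< lt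

mergeable-complete : ∀ B C → isFerm B ≡ false → isFerm C ≡ false → maxB B < minB C → mergeable B C ≡ true
mergeable-complete B C B≢θ C≢θ max<min rewrite B≢θ | C≢θ | <ᵇ-< max<min = refl

record _⋖_ (I J : SSC) : Set where
  constructor cover
  field ∈covers : J ∈ covers I

_⪯_ : SSC → SSC → Set
_⪯_ = Star _⋖_

data Merge : SSC → SSC → Set where
  merge : ∀ X B C Y → mergeable B C ≡ true → Merge (X ++ B ∷ C ∷ Y) (X ++ (B ∪ˢ C) ∷ Y)

Merge-∷ : ∀ A {I J} → Merge I J → Merge (A ∷ I) (A ∷ J)
Merge-∷ A (merge X B C Y m) = merge (A ∷ X) B C Y m

⋖⇒Merge : ∀ {I J} → I ⋖ J → Merge I J
⋖⇒Merge {B ∷ C ∷ I} (cover J∈) with mergeable B C in m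
... | true with J∈
...   | here refl = merge [] B C I m
...   | there J∈′ with ∈.∈-map⁻ (B ∷_) J∈′
...     | J′ , J′∈ , refl = Merge-∷ B (⋖⇒Merge {C ∷ I} (cover J′∈))
⋖⇒Merge {B ∷ C ∷ I} (cover J∈) | false with ∈.∈-map⁻ (B ∷_) J∈
... | J′ , J′∈ , refl = Merge-∷ B (⋖⇒Merge {C ∷ I} (cover J′∈))

merge⇒⋖ : ∀ X B C Y → mergeable B C ≡ true → (X ++ B ∷ C ∷ Y) ⋖ (X ++ (B ∪ˢ C) ∷ Y)
merge⇒⋖ X B C Y m = cover (go X)
  where
  go : ∀ X → (X ++ (B ∪ˢ C) ∷ Y) ∈ covers (X ++ B ∷ C ∷ Y)
  go [] rewrite m = here refl
  go (A ∷ []) = ∈.∈-++⁺ʳ _ (∈.∈-map⁺ (A ∷_) (go []))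
  go (A ∷ A′ ∷ X) = ∈.∈-++⁺ʳ _ (∈.∈-map⁺ (A ∷_) (go (A′ ∷ X)))

⋖-length : ∀ {I J} → I ⋖ J → length I ≡ suc (length J)
⋖-length I⋖J with ⋖⇒Merge I⋖J
... | merge X B C Y _ = trans (List.length-++ X) (trans (ℕ.+-suc (length X) _) (cong suc (sym (List.length-++ X))))

⋖-++ˡ : ∀ X {I J} → I ⋖ J → (X ++ I) ⋖ (X ++ J)
⋖-++ˡ X I⋖J with ⋖⇒Merge I⋖J
... | merge X′ B C Y m =
  subst₂ _⋖_ (List.++-assoc X X′ _) (List.++-assoc X X′ _) (merge⇒⋖ (X ++ X′) B C Y m)

⋖-++ʳ : ∀ Y {I J} → I ⋖ J → (I ++ Y) ⋖ (J ++ Y)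
⋖-++ʳ Y I⋖J with ⋖⇒Merge I⋖J
... | merge X B C Y′ m =
  subst₂ _⋖_ (sym (List.++-assoc X (B ∷ C ∷ Y′) Y)) (sym (List.++-assoc X (_ ∷ Y′) Y)) (merge⇒⋖ X B C (Y′ ++ Y) m)

⪯-++ : ∀ {I J I′ J′} → I ⪯ J → I′ ⪯ J′ → (I ++ I′) ⪯ (J ++ J′)
⪯-++ {J = J} {I′} I⪯J I′⪯J′ = gmap (_++ I′) (⋖-++ʳ I′) I⪯J ◅◅ gmap (J ++_) (⋖-++ˡ J) I′⪯J′

singletons-⪯ : ∀ {B} → B ≢ [] → Increasing B → isFerm B ≡ false → singletons B ⪯ (B ∷ [])
singletons-⪯ {[]} B≢[] _ _ = ⊥-elim (B≢[] refl)
singletons-⪯ {t ∷ []} _ _ _ = ε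
singletons-⪯ {zero ∷ t′ ∷ B} _ _ ()
singletons-⪯ {suc t ∷ t′ ∷ B} _ ((t<t′ ∷ _) ∷ B↑) B≢θ =
  ⪯-++ {I = (suc t ∷ []) ∷ []} ε (singletons-⪯ (λ ()) B↑ B≢θ) ◅◅ (merged ◅ ε)
  where
  max<min : maxB (suc t ∷ []) < minB (t′ ∷ B)
  max<min = subst₂ _<_ (sym (ℕ.⊔-identityʳ (suc t))) (sym (minB-increasing B↑)) t<t′
  merged : ((suc t ∷ []) ∷ (t′ ∷ B) ∷ []) ⋖ ((suc t ∷ t′ ∷ B) ∷ [])
  merged = subst (λ D → ((suc t ∷ []) ∷ (t′ ∷ B) ∷ []) ⋖ (D ∷ [])) (∪ˢ-separated ([] ∷ []) B↑ max<min)
                 (merge⇒⋖ [] (suc t ∷ []) (t′ ∷ B) [] (mergeable-complete (suc t ∷ []) (t′ ∷ B) refl B≢θ max<min))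

splitBlocks-⪯ : ∀ {J} → WellFormed J → splitBlocks J ⪯ J
splitBlocks-⪯ [] = ε
splitBlocks-⪯ {B ∷ J} ((B≢[] , B↑) ∷ J-wf) with isFerm B in θ
... | true = ⪯-++ {I = B ∷ []} ε (splitBlocks-⪯ J-wf)
... | false = ⪯-++ (singletons-⪯ B≢[] B↑ θ) (splitBlocks-⪯ J-wf)

⋖-invariant : ∀ {I J} → I ⋖ J → WellFormed I → WellFormed J × splitBlocks J ≡ splitBlocks I
⋖-invariant I⋖J I-wf with ⋖⇒Merge I⋖J
... | merge X B C Y m with All.++⁻ X I-wf | mergeable-sound B C m
...   | X-wf , ((B≢[] , B↑) ∷ (_ , C↑) ∷ Y-wf) | B≢θ , C≢θ , max<min rewrite ∪ˢ-separated B↑ C↑ max<min =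
  All.++⁺ X-wf ((B++C≢[] B≢[] , ++-increasing B↑ C↑ max<min) ∷ Y-wf) ,
  (begin
    splitBlocks (X ++ (B ++ C) ∷ Y)                        ≡⟨ splitBlocks-++ X _ ⟩
    splitBlocks X ++ splitBlock (B ++ C) ++ splitBlocks Y   ≡⟨ cong (λ S → splitBlocks X ++ S ++ splitBlocks Y) (splitBlock-++ B C B≢θ C≢θ) ⟩
    splitBlocks X ++ (splitBlock B ++ splitBlock C) ++ splitBlocks Y ≡⟨ cong (splitBlocks X ++_) (List.++-assoc (splitBlock B) _ _) ⟩
    splitBlocks X ++ splitBlocks (B ∷ C ∷ Y)               ≡⟨ splitBlocks-++ X _ ⟨
    splitBlocks (X ++ B ∷ C ∷ Y)                           ∎)
  where
  open ≡-Reasoning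
  B++C≢[] : ∀ {B} → B ≢ [] → B ++ C ≢ []
  B++C≢[] {[]} B≢[] _ = B≢[] refl
  B++C≢[] {_ ∷ _} _ ()

⪯-invariant : ∀ {I K} → I ⪯ K → WellFormed I → WellFormed K × splitBlocks K ≡ splitBlocks I
⪯-invariant ε I-wf = I-wf , refl
⪯-invariant (I⋖J ◅ J⪯K) I-wf with ⋖-invariant I⋖J I-wf
... | J-wf , J≡I with ⪯-invariant J⪯K J-wf
...   | K-wf , K≡J = K-wf , trans K≡J J≡I

⪯⇒∈upF : ∀ {I K} k → length I ≤ k → I ⪯ K → K ∈ upF k I
⪯⇒∈upF zero _ ε = here refl
⪯⇒∈upF (suc k) _ ε = here refl
⪯⇒∈upF zero I≤0 (I⋖J ◅ _) with () ← subst (_≤ 0) (⋖-length I⋖J) I≤0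
⪯⇒∈upF (suc k) I≤k (I⋖J ◅ J⪯K) =
  there (∈.∈-concat⁺′ (⪯⇒∈upF k (ℕ.≤-pred (subst (_≤ suc k) (⋖-length I⋖J) I≤k)) J⪯K) (∈.∈-map⁺ (upF k) (_⋖_.∈covers I⋖J)))

∈upF⇒⪯ : ∀ k {I K} → K ∈ upF k I → I ⪯ K
∈upF⇒⪯ zero (here refl) = ε
∈upF⇒⪯ (suc k) (here refl) = ε
∈upF⇒⪯ (suc k) {I} (there K∈) with ∈.∈-concat⁻′ (map (upF k) (covers I)) K∈
... | _ , K∈up , up∈ with ∈.∈-map⁻ (upF k) up∈
...   | J , J∈ , refl = cover {I} J∈ ◅ ∈upF⇒⪯ k K∈up

∈up⇒⪯ : ∀ {I K} → K ∈ up I → I ⪯ K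
∈up⇒⪯ {I} K∈ = ∈upF⇒⪯ (length I) (∈.∈-deduplicate⁻ _≟SSC_ (upF (length I) I) K∈)

⪯⇒∈up : ∀ {I K} → I ⪯ K → K ∈ up I
⪯⇒∈up {I} I⪯K = ∈.∈-deduplicate⁺ _≟SSC_ (⪯⇒∈upF (length I) ℕ.≤-refl I⪯K)

up-unique : ∀ I → Unique (up I)
up-unique I = deduplicate-! _≟SSC_ (upF (length I) I)

SingletonsOrFermionic : SSC → Set
SingletonsOrFermionic = All (λ B → 0 ∉ B → length B ≡ 1)

splitBlocks-identity : ∀ {I} → SingletonsOrFermionic I → splitBlocks I ≡ I
splitBlocks-identity [] = refl
splitBlocks-identity {B ∷ I} (B-ok ∷ I-ok) = cong₂ _++_ (splitBlock-identity B B-ok) (splitBlocks-identity I-ok)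
  where
  splitBlock-identity : ∀ B → (0 ∉ B → length B ≡ 1) → splitBlock B ≡ B ∷ []
  splitBlock-identity B B-ok with isFerm B in θ
  ... | true = refl
  ... | false with B | B-ok (memB-false⇒∉ B θ)
  ...   | _ ∷ [] | _ = refl

superperm-wellFormed : ∀ {I} → IsSuperperm I → WellFormed I
superperm-wellFormed ((blocks , _) , _) = All.map (λ (B≢[] , B-linked) → B≢[] , Linked⇒Increasing B-linked) blocks

superperm-splitBlocks : ∀ {I} → IsSuperperm I → splitBlocks I ≡ I
superperm-splitBlocks (_ , I-ok) = splitBlocks-identity I-ok

∈up⇒splitBlocks : ∀ {I K} → WellFormed I → K ∈ up I → WellFormed K × splitBlocks K ≡ splitBlocks I
∈up⇒splitBlocks I-wf K∈ = ⪯-invariant (∈up⇒⪯ K∈) I-wf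

∈up-splitBlocks : ∀ {K} → WellFormed K → K ∈ up (splitBlocks K)
∈up-splitBlocks K-wf = ⪯⇒∈up (splitBlocks-⪯ K-wf)

∈up-superperm⇔ : ∀ {I K} → IsSuperperm I → WellFormed K → K ∈ up I ⇔ splitBlocks K ≡ I
∈up-superperm⇔ {I} {K} I-sp K-wf =
  mk⇔ (λ K∈ → trans (proj₂ (∈up⇒splitBlocks (superperm-wellFormed I-sp) K∈)) (superperm-splitBlocks I-sp))
      (λ K≡I → subst (λ J → K ∈ up J) K≡I (∈up-splitBlocks K-wf))

-- The fundamental basis on monomials

coeff : List (ℚ × SSC) → SSC → ℚ
coeff p K = sumℚ (map (λ q → when (K ≟SSC proj₂ q) (proj₁ q)) p)

toSeries-++ : ∀ e e′ u → toSeries (e ++ e′) u ≡ toSeries e u ℚ.+ toSeries e′ u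
toSeries-++ e e′ u = trans (cong sumℚ (List.map-++ term e e′)) (sumℚ-++ (map term e) (map term e′))
  where
  term : ℚ × SSC → ℚ
  term q = proj₁ q ℚ.* M (proj₂ q) u

series-Q : ∀ {I} → IsSuperperm I → ∀ c u →
           toSeries (map (λ q → c ℚ.* proj₁ q , proj₂ q) (Q I)) u ≡ when (superpermOf u ≟SSC I) c
series-Q {I} I-sp c u = begin
  toSeries (map (λ q → c ℚ.* proj₁ q , proj₂ q) (map (1ℚ ,_) (up I))) u
    ≡⟨ cong sumℚ (trans (sym (List.map-∘ (map (1ℚ ,_) (up I)))) (sym (List.map-∘ (up I)))) ⟩
  sumℚ (map (λ J → (c ℚ.* 1ℚ) ℚ.* M J u) (up I))
    ≡⟨ sumℚ-cong (up I) (λ {J} _ → scale-when (I[ u ] ≟SSC J) c) ⟩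
  sumℚ (map (λ J → when (I[ u ] ≟SSC J) c) (up I))
    ≡⟨ sumℚ-indicator _≟SSC_ (λ _ → c) I[ u ] (up-unique I) ⟩
  when (I[ u ] ∈? up I) c
    ≡⟨ when-⇔ (I[ u ] ∈? up I) (superpermOf u ≟SSC I) c (∈up-superperm⇔ I-sp (I[]-wellFormed u)) ⟩
  when (superpermOf u ≟SSC I) c ∎
  where
  open ≡-Reasoning
  open DecMembership _≟SSC_ using (_∈?_)

series-linQ : ∀ {p} → AllSP p → ∀ u → toSeries (linQ p) u ≡ coeff p (superpermOf u)
series-linQ [] u = refl
series-linQ {(c , I) ∷ p} (I-sp ∷ p-sp) u =
  trans (toSeries-++ (map (λ q → c ℚ.* proj₁ q , proj₂ q) (Q I)) (linQ p) u)
        (cong₂ ℚ._+_ (series-Q I-sp c u) (series-linQ p-sp u))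

superperm-[] : IsSuperperm []
superperm-[] = ([] , ↭-refl) , []

coeff-unit : ∀ u → NormalMono u → coeff ((1ℚ , []) ∷ []) (superpermOf u) ≡ oneS u
coeff-unit ([] , []) _ = refl
coeff-unit ([] , a ∷ w) _ =
  trans (cong (ℚ._+ 0ℚ) (when-no (superpermOf ([] , a ∷ w) ≟SSC []) 1ℚ
          (λ K≡[] → ℕ.0≢1+n (trans (sym (cong xDegree K≡[])) (xDegree-superpermOf ([] , a ∷ w))))))
        (ℚ.+-identityʳ 0ℚ)
coeff-unit (c ∷ C , w) C-linked =
  trans (cong (ℚ._+ 0ℚ) (when-no (superpermOf (c ∷ C , w) ≟SSC []) 1ℚ
          (λ K≡[] → ℕ.0≢1+n (trans (sym (cong θDegree K≡[])) (θDegree-superpermOf (c ∷ C) w (Linked⇒Increasing C-linked))))))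
        (ℚ.+-identityʳ 0ℚ)

unit-closed : Σ (List (ℚ × SSC)) λ r → AllSP r × (∀ u → NormalMono u → toSeries (linQ r) u ≡ oneS u)
unit-closed = (1ℚ , []) ∷ [] , superperm-[] ∷ [] , λ u u-normal → trans (series-linQ (superperm-[] ∷ []) u) (coeff-unit u u-normal)

-- The product

Mask : Set
Mask = List Bool

selectˡ : Mask → List ℕ → List ℕ
selectˡ [] _ = []
selectˡ (_ ∷ _) [] = []
selectˡ (true ∷ ms) (c ∷ C) = c ∷ selectˡ ms C
selectˡ (false ∷ ms) (c ∷ C) = selectˡ ms C

selectʳ : Mask → List ℕ → List ℕ
selectʳ [] _ = []
selectʳ (_ ∷ _) [] = []
selectʳ (true ∷ ms) (c ∷ C) = selectʳ ms C
selectʳ (false ∷ ms) (c ∷ C) = c ∷ selectʳ ms C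

masks : ℕ → List Mask
masks zero = [] ∷ []
masks (suc m) = concatMap (λ ms → (true ∷ ms) ∷ (false ∷ ms) ∷ []) (masks m)

splits≡masks : ∀ C → splits C ≡ map (λ ms → selectˡ ms C , selectʳ ms C) (masks (length C))
splits≡masks [] = refl
splits≡masks (c ∷ C) = begin
  concatMap extend (splits C)
    ≡⟨ cong (concatMap extend) (splits≡masks C) ⟩
  concatMap extend (map (λ ms → selectˡ ms C , selectʳ ms C) (masks (length C)))
    ≡⟨ List.concatMap-map extend _ (masks (length C)) ⟩
  concatMap (λ ms → map (λ ms → selectˡ ms (c ∷ C) , selectʳ ms (c ∷ C)) ((true ∷ ms) ∷ (false ∷ ms) ∷ [])) (masks (length C))
    ≡⟨ List.map-concatMap (λ ms → selectˡ ms (c ∷ C) , selectʳ ms (c ∷ C)) _ (masks (length C)) ⟨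
  map (λ ms → selectˡ ms (c ∷ C) , selectʳ ms (c ∷ C)) (masks (length (c ∷ C))) ∎
  where
  open ≡-Reasoning
  extend : List ℕ × List ℕ → List (List ℕ × List ℕ)
  extend p = (c ∷ proj₁ p , proj₂ p) ∷ (proj₁ p , c ∷ proj₂ p) ∷ []

length-∈masks : ∀ m {ms} → ms ∈ masks m → length ms ≡ m
length-∈masks zero (here refl) = refl
length-∈masks (suc m) ms∈ with ∈.∈-concat⁻′ (map (λ ms → (true ∷ ms) ∷ (false ∷ ms) ∷ []) (masks m)) ms∈
... | _ , ms∈xs , xs∈ with ∈.∈-map⁻ (λ ms → (true ∷ ms) ∷ (false ∷ ms) ∷ []) xs∈
...   | ms′ , ms′∈ , refl with ms∈xs
...     | here refl = cong suc (length-∈masks m ms′∈)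
...     | there (here refl) = cong suc (length-∈masks m ms′∈)

module _ {P : ℕ → Set} where

  All-selectˡ : ∀ ms {C} → All P C → All P (selectˡ ms C)
  All-selectˡ (true ∷ ms) (p ∷ ps) = p ∷ All-selectˡ ms ps
  All-selectˡ (false ∷ ms) (p ∷ ps) = All-selectˡ ms ps
  All-selectˡ [] _ = []
  All-selectˡ (_ ∷ _) [] = []

  All-selectʳ : ∀ ms {C} → All P C → All P (selectʳ ms C)
  All-selectʳ (true ∷ ms) (p ∷ ps) = All-selectʳ ms ps
  All-selectʳ (false ∷ ms) (p ∷ ps) = p ∷ All-selectʳ ms ps
  All-selectʳ [] _ = []
  All-selectʳ (_ ∷ _) [] = []

selectˡ-increasing : ∀ ms {C} → Increasing C → Increasing (selectˡ ms C)
selectˡ-increasing (true ∷ ms) (c< ∷ C↑) = All-selectˡ ms c< ∷ selectˡ-increasing ms C↑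
selectˡ-increasing (false ∷ ms) (_ ∷ C↑) = selectˡ-increasing ms C↑
selectˡ-increasing [] _ = []
selectˡ-increasing (_ ∷ _) [] = []

selectʳ-increasing : ∀ ms {C} → Increasing C → Increasing (selectʳ ms C)
selectʳ-increasing (true ∷ ms) (_ ∷ C↑) = selectʳ-increasing ms C↑
selectʳ-increasing (false ∷ ms) (c< ∷ C↑) = All-selectʳ ms c< ∷ selectʳ-increasing ms C↑
selectʳ-increasing [] _ = []
selectʳ-increasing (_ ∷ _) [] = []

length-select : ∀ ms C → length ms ≡ length C → length (selectˡ ms C) + length (selectʳ ms C) ≡ length C
length-select [] [] _ = refl
length-select (true ∷ ms) (c ∷ C) eq = cong suc (length-select ms C (ℕ.suc-injective eq))
length-select (false ∷ ms) (c ∷ C) eq = trans (ℕ.+-suc _ _) (cong suc (length-select ms C (ℕ.suc-injective eq)))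

trues : Mask → ℕ
trues [] = 0
trues (b ∷ ms) = if b then suc (trues ms) else trues ms

-- The number of pairs (false, true), in this order, in a mask: θ_A θ_B = (-1)^maskInversions θ_{A ∪ B}.
maskInversions : Mask → ℕ
maskInversions [] = 0
maskInversions (true ∷ ms) = maskInversions ms
maskInversions (false ∷ ms) = trues ms + maskInversions ms

length-selectˡ : ∀ ms C → length ms ≡ length C → length (selectˡ ms C) ≡ trues ms
length-selectˡ [] [] _ = refl
length-selectˡ (true ∷ ms) (c ∷ C) eq = cong suc (length-selectˡ ms C (ℕ.suc-injective eq))
length-selectˡ (false ∷ ms) (c ∷ C) eq = length-selectˡ ms C (ℕ.suc-injective eq)

inversions-∷ʳ : ∀ c A B → All (c <_) A → inversions A (c ∷ B) ≡ length A + inversions A B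
inversions-∷ʳ c [] B _ = refl
inversions-∷ʳ c (α ∷ A) B (c<α ∷ c<A) rewrite <ᵇ-< c<α =
  cong suc (trans (cong (below α B +_) (inversions-∷ʳ c A B c<A))
                  (trans (sym (ℕ.+-assoc (below α B) (length A) _))
                         (trans (cong (_+ inversions A B) (ℕ.+-comm (below α B) (length A))) (ℕ.+-assoc (length A) _ _))))
  where
  below : ℕ → List ℕ → ℕ
  below α B = length (filterᵇ (λ β → β <ᵇ α) B)

inversions-select : ∀ ms C → Increasing C → length ms ≡ length C →
                    inversions (selectˡ ms C) (selectʳ ms C) ≡ maskInversions ms
inversions-select [] [] _ _ = refl
inversions-select (true ∷ ms) (c ∷ C) (c< ∷ C↑) eq =
  cong₂ _+_ (cong length (filterᵇ-none (λ β → β <ᵇ c) (All.map (λ c<β → <ᵇ-≥ (ℕ.<⇒≤ c<β)) (All-selectʳ ms c<))))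
            (inversions-select ms C C↑ (ℕ.suc-injective eq))
inversions-select (false ∷ ms) (c ∷ C) (c< ∷ C↑) eq =
  trans (inversions-∷ʳ c (selectˡ ms C) (selectʳ ms C) (All-selectˡ ms c<))
        (cong₂ _+_ (length-selectˡ ms C (ℕ.suc-injective eq)) (inversions-select ms C C↑ (ℕ.suc-injective eq)))

maskOf : Mask → List ℕ → ℕ → Bool
maskOf (b ∷ ms) (c ∷ C) v = if c ≡ᵇ v then b else maskOf ms C v
maskOf _ _ v = false

maskOf-tail : ∀ b ms c {C} → All (c <_) C → All (λ x → maskOf (b ∷ ms) (c ∷ C) x ≡ maskOf ms C x) C
maskOf-tail b ms c {C} c< = All.map (λ {x} c<x → cong (λ e → if e then b else maskOf ms C x) (≡ᵇ-≢ (ℕ.<⇒≢ c<x))) c<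

map-maskOf : ∀ ms C → Increasing C → length ms ≡ length C → map (maskOf ms C) C ≡ ms
map-maskOf [] [] _ _ = refl
map-maskOf (b ∷ ms) (c ∷ C) (c< ∷ C↑) eq rewrite ≡ᵇ-refl c =
  cong (b ∷_) (trans (List.map-cong-local (maskOf-tail b ms c c<)) (map-maskOf ms C C↑ (ℕ.suc-injective eq)))

filter-maskOf : ∀ ms C → Increasing C → length ms ≡ length C → filterᵇ (maskOf ms C) C ≡ selectˡ ms C
filter-maskOf [] [] _ _ = refl
filter-maskOf (true ∷ ms) (c ∷ C) (c< ∷ C↑) eq rewrite ≡ᵇ-refl c =
  cong (c ∷_) (trans (filterᵇ-cong-local (maskOf-tail true ms c c<)) (filter-maskOf ms C C↑ (ℕ.suc-injective eq)))
filter-maskOf (false ∷ ms) (c ∷ C) (c< ∷ C↑) eq rewrite ≡ᵇ-refl c =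
  trans (filterᵇ-cong-local (maskOf-tail false ms c c<)) (filter-maskOf ms C C↑ (ℕ.suc-injective eq))

filter-not-maskOf : ∀ ms C → Increasing C → length ms ≡ length C → filterᵇ (λ v → not (maskOf ms C v)) C ≡ selectʳ ms C
filter-not-maskOf [] [] _ _ = refl
filter-not-maskOf (true ∷ ms) (c ∷ C) (c< ∷ C↑) eq rewrite ≡ᵇ-refl c =
  trans (filterᵇ-cong-local (All.map (cong not) (maskOf-tail true ms c c<))) (filter-not-maskOf ms C C↑ (ℕ.suc-injective eq))
filter-not-maskOf (false ∷ ms) (c ∷ C) (c< ∷ C↑) eq rewrite ≡ᵇ-refl c =
  cong (c ∷_) (trans (filterᵇ-cong-local (All.map (cong not) (maskOf-tail false ms c c<))) (filter-not-maskOf ms C C↑ (ℕ.suc-injective eq)))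

lowerPart : ℕ → ℕ → List ℕ
lowerPart i t = if (0 <ᵇ t) ∧ (t <ᵇ suc i) then t ∷ [] else []

upperPart : ℕ → ℕ → List ℕ
upperPart i t = if i <ᵇ t then t ∸ i ∷ [] else []

lowerPart-≤ : ∀ {i t} → 0 < t → t ≤ i → lowerPart i t ≡ t ∷ []
lowerPart-≤ 0<t t≤i rewrite <ᵇ-< 0<t | <ᵇ-< (s≤s t≤i) = refl

lowerPart-> : ∀ {i t} → i < t → lowerPart i t ≡ []
lowerPart-> {i} {suc t} i<t rewrite <ᵇ-≥ {suc t} {suc i} i<t = refl

upperPart-> : ∀ {i t} → i < t → upperPart i t ≡ t ∸ i ∷ []
upperPart-> i<t rewrite <ᵇ-< i<t = refl

upperPart-≤ : ∀ {i t} → t ≤ i → upperPart i t ≡ []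
upperPart-≤ t≤i rewrite <ᵇ-≥ t≤i = refl

positions-lowerPart : ∀ k i w v → concatMap (lowerPart (k + i)) (positions k w v) ≡ positions k (take i w) v
positions-lowerPart k zero w v =
  concatMap-[] (All.map (λ k<t → lowerPart-> (subst (_< _) (sym (ℕ.+-identityʳ k)) k<t)) (positions-> k w v))
positions-lowerPart k (suc i) [] v = refl
positions-lowerPart k (suc i) (a ∷ w) v with a ≡ᵇ v
... | true rewrite lowerPart-≤ {k + suc i} {suc k} (s≤s z≤n) (subst (suc k ≤_) (sym (ℕ.+-suc k i)) (s≤s (ℕ.m≤m+n k i))) =
  cong (suc k ∷_) tail
  where
  tail : concatMap (lowerPart (k + suc i)) (positions (suc k) w v) ≡ positions (suc k) (take i w) v
  tail = trans (cong (λ j → concatMap (lowerPart j) (positions (suc k) w v)) (ℕ.+-suc k i)) (positions-lowerPart (suc k) i w v)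
... | false = trans (cong (λ j → concatMap (lowerPart j) (positions (suc k) w v)) (ℕ.+-suc k i)) (positions-lowerPart (suc k) i w v)

positions-upperPart-≤ : ∀ {j} k w v → j ≤ k → concatMap (upperPart j) (positions k w v) ≡ positions (k ∸ j) w v
positions-upperPart-≤ k [] v _ = refl
positions-upperPart-≤ {j} k (a ∷ w) v j≤k with a ≡ᵇ v
... | true rewrite upperPart-> {j} {suc k} (s≤s j≤k) =
  cong₂ _∷_ suc∸ (trans (positions-upperPart-≤ (suc k) w v (ℕ.m≤n⇒m≤1+n j≤k)) (cong (λ n → positions n w v) suc∸))
  where
  suc∸ : suc k ∸ j ≡ suc (k ∸ j)
  suc∸ = ℕ.+-∸-assoc 1 j≤k
... | false = trans (positions-upperPart-≤ (suc k) w v (ℕ.m≤n⇒m≤1+n j≤k)) (cong (λ n → positions n w v) (ℕ.+-∸-assoc 1 j≤k))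

positions-upperPart : ∀ k i w v → concatMap (upperPart (k + i)) (positions k w v) ≡ positions 0 (drop i w) v
positions-upperPart k zero w v =
  trans (positions-upperPart-≤ k w v (ℕ.≤-reflexive (ℕ.+-identityʳ k)))
        (cong (λ n → positions n w v) (trans (cong (k ∸_) (ℕ.+-identityʳ k)) (ℕ.n∸n≡0 k)))
positions-upperPart k (suc i) [] v = refl
positions-upperPart k (suc i) (a ∷ w) v with a ≡ᵇ v
... | true rewrite upperPart-≤ {k + suc i} {suc k} (subst (suc k ≤_) (sym (ℕ.+-suc k i)) (s≤s (ℕ.m≤m+n k i))) =
  trans (cong (λ j → concatMap (upperPart j) (positions (suc k) w v)) (ℕ.+-suc k i)) (positions-upperPart (suc k) i w v)
... | false = trans (cong (λ j → concatMap (upperPart j) (positions (suc k) w v)) (ℕ.+-suc k i)) (positions-upperPart (suc k) i w v)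

-- The superpermutation of a factor of a monomial u, read off that of u: `part` cuts each
-- position list to the positions of the factor, and a fermionic block whose θ gets mask
-- bit b keeps its θ in the factor iff `keep b`.
mutual
  restrict : (Bool → Bool) → (ℕ → List ℕ) → Mask → SSC → SSC
  restrict keep part ms [] = []
  restrict keep part ms (B ∷ K) = restrictBlock keep part (isFerm B) ms B K

  restrictBlock : (Bool → Bool) → (ℕ → List ℕ) → Bool → Mask → Block → SSC → SSC
  restrictBlock keep part true (b ∷ ms) B K =
    (if keep b then (0 ∷ concatMap part B) ∷ [] else singletons (concatMap part B)) ++ restrict keep part ms K
  restrictBlock keep part true [] B K = restrict keep part [] K
  restrictBlock keep part false ms B K = singletons (concatMap part B) ++ restrict keep part ms K

restrictˡ : Mask → ℕ → SSC → SSC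
restrictˡ ms i = restrict (λ b → b) (lowerPart i) ms

restrictʳ : Mask → ℕ → SSC → SSC
restrictʳ ms i = restrict not (upperPart i) ms

restrict-singletons : ∀ keep part ms {P} K → Positive P →
                      restrict keep part ms (singletons P ++ K) ≡ singletons (concatMap part P) ++ restrict keep part ms K
restrict-singletons keep part ms K [] = refl
restrict-singletons keep part ms {suc t ∷ P} K (_ ∷ P>0) = begin
  singletons (part (suc t) ++ []) ++ restrict keep part ms (singletons P ++ K)
    ≡⟨ cong₂ (λ Q R → singletons Q ++ R) (List.++-identityʳ (part (suc t))) (restrict-singletons keep part ms K P>0) ⟩
  singletons (part (suc t)) ++ singletons (concatMap part P) ++ restrict keep part ms K
    ≡⟨ List.++-assoc (singletons (part (suc t))) _ _ ⟨
  (singletons (part (suc t)) ++ singletons (concatMap part P)) ++ restrict keep part ms K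
    ≡⟨ cong (_++ restrict keep part ms K) (List.map-++ (_∷ []) (part (suc t)) (concatMap part P)) ⟨
  singletons (concatMap part (suc t ∷ P)) ++ restrict keep part ms K ∎
  where open ≡-Reasoning

module _ (keep : Bool → Bool) (part : ℕ → List ℕ) (part-0 : part 0 ≡ []) (a : ℕ → Bool) (C w w′ : List ℕ)
         (part-positions : ∀ v → concatMap part (positions 0 w v) ≡ positions 0 w′ v) where

  private
    C′ = filterᵇ (λ x → keep (a x)) C

  restrict-superpermBelow : ∀ vs →
    restrict keep part (map a (filterᵇ (λ v → memB v C) vs)) (concatMap (λ v → splitBlock (block C w v)) vs)
    ≡ concatMap (λ v → splitBlock (block C′ w′ v)) vs
  restrict-superpermBelow [] = refl
  restrict-superpermBelow (v ∷ vs) = by-θ (memB v C) refl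
    where
    open ≡-Reasoning
    rest = concatMap (λ v → splitBlock (block C w v)) vs
    rest′ = concatMap (λ v → splitBlock (block C′ w′ v)) vs
    ms = map a (filterᵇ (λ v → memB v C) vs)
    pos′ = positions 0 w′ v

    by-θ : ∀ b → memB v C ≡ b →
      restrict keep part (map a (filterᵇ (λ v → memB v C) (v ∷ vs))) (splitBlock (block C w v) ++ rest)
      ≡ splitBlock (block C′ w′ v) ++ rest′
    by-θ true v∈C = begin
      restrict keep part (map a (filterᵇ (λ v → memB v C) (v ∷ vs))) (splitBlock (block C w v) ++ rest)
        ≡⟨ cong₂ (λ xs K → restrict keep part (map a xs) (K ++ rest)) (filterᵇ-accept vs v∈C) (splitBlock-block-θ {C} w v v∈C) ⟩
      (if keep (a v) then (0 ∷ concatMap part (0 ∷ positions 0 w v)) ∷ [] else singletons (concatMap part (0 ∷ positions 0 w v)))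
        ++ restrict keep part ms rest
        ≡⟨ cong₂ (λ P K → (if keep (a v) then (0 ∷ P) ∷ [] else singletons P) ++ K)
                 (trans (cong (_++ concatMap part (positions 0 w v)) part-0) (part-positions v)) (restrict-superpermBelow vs) ⟩
      (if keep (a v) then (0 ∷ pos′) ∷ [] else singletons pos′) ++ rest′
        ≡⟨ cong (_++ rest′) (by-keep (keep (a v)) refl) ⟨
      splitBlock (block C′ w′ v) ++ rest′ ∎
      where
      v∈C′ : memB v C′ ≡ keep (a v)
      v∈C′ = trans (memB-filter (λ x → keep (a x)) v C) (trans (cong (keep (a v) ∧_) v∈C) (∧-identityʳ _))
      by-keep : ∀ k → keep (a v) ≡ k → splitBlock (block C′ w′ v) ≡ (if k then (0 ∷ pos′) ∷ [] else singletons pos′)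
      by-keep true kv = splitBlock-block-θ {C′} w′ v (trans v∈C′ kv)
      by-keep false kv = splitBlock-block-x {C′} w′ v (trans v∈C′ kv)
    by-θ false v∉C = begin
      restrict keep part (map a (filterᵇ (λ v → memB v C) (v ∷ vs))) (splitBlock (block C w v) ++ rest)
        ≡⟨ cong₂ (λ xs K → restrict keep part (map a xs) (K ++ rest)) (filterᵇ-reject vs v∉C) (splitBlock-block-x {C} w v v∉C) ⟩
      restrict keep part ms (singletons (positions 0 w v) ++ rest)
        ≡⟨ restrict-singletons keep part ms rest (positions-positive w v) ⟩
      singletons (concatMap part (positions 0 w v)) ++ restrict keep part ms rest
        ≡⟨ cong₂ (λ P K → singletons P ++ K) (part-positions v) (restrict-superpermBelow vs) ⟩
      singletons pos′ ++ rest′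
        ≡⟨ cong (_++ rest′) (splitBlock-block-x {C′} w′ v v∉C′) ⟨
      splitBlock (block C′ w′ v) ++ rest′ ∎
      where
      v∉C′ : memB v C′ ≡ false
      v∉C′ = trans (memB-filter (λ x → keep (a x)) v C) (trans (cong (keep (a v) ∧_) v∉C) (∧-zeroʳ _))

  superpermOf-restrict : Increasing C → All (_< suc (maxVar (C , w))) w′ →
                         superpermOf (C′ , w′) ≡ restrict keep part (map a C) (superpermOf (C , w))
  superpermOf-restrict C↑ w′<b = sym (begin
    restrict keep part (map a C) (superpermOf (C , w))
      ≡⟨ cong₂ (λ xs K → restrict keep part (map a xs) K)
               (sym (filter-upTo (λ v → memB v C) C↑ (proj₁ vb) (λ _ → refl))) (superpermOf≡superpermBelow-max (C , w)) ⟩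
    restrict keep part (map a (filterᵇ (λ v → memB v C) (upTo b))) (superpermBelow b (C , w))
      ≡⟨ restrict-superpermBelow (upTo b) ⟩
    superpermBelow b (C′ , w′)
      ≡⟨ superpermOf≡superpermBelow (C′ , w′) (All.filter⁺ (λ x → T? (keep (a x))) (proj₁ vb) , w′<b) ⟨
    superpermOf (C′ , w′) ∎)
    where
    open ≡-Reasoning
    b = suc (maxVar (C , w))
    vb = VarsBelow-maxVar (C , w)

superpermOf-leftFactor : ∀ ms i {C} w → Increasing C → length ms ≡ length C →
                         superpermOf (selectˡ ms C , take i w) ≡ restrictˡ ms i (superpermOf (C , w))
superpermOf-leftFactor ms i {C} w C↑ ms≡C = begin
  superpermOf (selectˡ ms C , take i w)
    ≡⟨ cong (λ C′ → superpermOf (C′ , take i w)) (filter-maskOf ms C C↑ ms≡C) ⟨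
  superpermOf (filterᵇ (maskOf ms C) C , take i w)
    ≡⟨ superpermOf-restrict (λ b → b) (lowerPart i) refl (maskOf ms C) C w (take i w) (positions-lowerPart 0 i w) C↑
                            (All.take⁺ i (proj₂ (VarsBelow-maxVar (C , w)))) ⟩
  restrictˡ (map (maskOf ms C) C) i (superpermOf (C , w))
    ≡⟨ cong (λ ms′ → restrictˡ ms′ i (superpermOf (C , w))) (map-maskOf ms C C↑ ms≡C) ⟩
  restrictˡ ms i (superpermOf (C , w)) ∎
  where open ≡-Reasoning

superpermOf-rightFactor : ∀ ms i {C} w → Increasing C → length ms ≡ length C →
                          superpermOf (selectʳ ms C , drop i w) ≡ restrictʳ ms i (superpermOf (C , w))
superpermOf-rightFactor ms i {C} w C↑ ms≡C = begin
  superpermOf (selectʳ ms C , drop i w)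
    ≡⟨ cong (λ C′ → superpermOf (C′ , drop i w)) (filter-not-maskOf ms C C↑ ms≡C) ⟨
  superpermOf (filterᵇ (λ v → not (maskOf ms C v)) C , drop i w)
    ≡⟨ superpermOf-restrict not (upperPart i) refl (maskOf ms C) C w (drop i w) (positions-upperPart 0 i w) C↑
                            (All.drop⁺ i (proj₂ (VarsBelow-maxVar (C , w)))) ⟩
  restrictʳ (map (maskOf ms C) C) i (superpermOf (C , w))
    ≡⟨ cong (λ ms′ → restrictʳ ms′ i (superpermOf (C , w))) (map-maskOf ms C C↑ ms≡C) ⟩
  restrictʳ ms i (superpermOf (C , w)) ∎
  where open ≡-Reasoning

productAt : List (ℚ × SSC) → List (ℚ × SSC) → Mono → ℚ
productAt p q (C , w) =
  sumℚ (map (λ i → sumℚ (map (λ ms → sgn (maskInversions ms) ℚ.* coeff p (superpermOf (selectˡ ms C , take i w))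
                                                              ℚ.* coeff q (superpermOf (selectʳ ms C , drop i w)))
                             (masks (length C))))
            (upTo (suc (length w))))

productCoeff : List (ℚ × SSC) → List (ℚ × SSC) → SSC → ℚ
productCoeff p q K =
  sumℚ (map (λ i → sumℚ (map (λ ms → sgn (maskInversions ms) ℚ.* coeff p (restrictˡ ms i K) ℚ.* coeff q (restrictʳ ms i K))
                             (masks (θDegree K))))
            (upTo (suc (xDegree K))))

⋆-productAt : ∀ {p q} → AllSP p → AllSP q → ∀ u → NormalMono u →
              (toSeries (linQ p) ⋆ toSeries (linQ q)) u ≡ productAt p q u
⋆-productAt {p} {q} p-sp q-sp (C , w) C-linked = sumℚ-cong (upTo (suc (length w))) λ {i} _ →
  trans (cong (λ prs → sumℚ (map (term i) prs)) (splits≡masks C))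
        (trans (sumℚ-map-map (term i) (λ ms → selectˡ ms C , selectʳ ms C) (masks (length C)))
               (sumℚ-cong (masks (length C)) λ {ms} ms∈ →
                 cong₂ ℚ._*_ (cong₂ ℚ._*_ (cong sgn (inversions-select ms C C↑ (length-∈masks _ ms∈)))
                                          (series-linQ p-sp (selectˡ ms C , take i w)))
                             (series-linQ q-sp (selectʳ ms C , drop i w))))
  where
  C↑ = Linked⇒Increasing C-linked
  term : ℕ → List ℕ × List ℕ → ℚ
  term i pr = sgn (inversions (proj₁ pr) (proj₂ pr)) ℚ.* toSeries (linQ p) (proj₁ pr , take i w)
                                                     ℚ.* toSeries (linQ q) (proj₂ pr , drop i w)

productAt≡productCoeff : ∀ p q u → NormalMono u → productAt p q u ≡ productCoeff p q (superpermOf u)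
productAt≡productCoeff p q (C , w) C-linked =
  trans (sumℚ-cong (upTo (suc (length w))) λ {i} _ → sumℚ-cong (masks (length C)) λ {ms} ms∈ →
           cong₂ (λ K L → sgn (maskInversions ms) ℚ.* coeff p K ℚ.* coeff q L)
                 (superpermOf-leftFactor ms i w C↑ (length-∈masks _ ms∈))
                 (superpermOf-rightFactor ms i w C↑ (length-∈masks _ ms∈)))
        (cong₂ (λ n m → sumℚ (map (λ i → sumℚ (map (λ ms → sgn (maskInversions ms) ℚ.* coeff p (restrictˡ ms i K)
                                                                                 ℚ.* coeff q (restrictʳ ms i K))
                                                    (masks m)))
                                   (upTo (suc n))))
               (sym (xDegree-superpermOf (C , w))) (sym (θDegree-superpermOf C w C↑)))
  where
  C↑ = Linked⇒Increasing C-linked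
  K = superpermOf (C , w)

maxOver : (SSC → ℕ) → List (ℚ × SSC) → ℕ
maxOver f p = foldr _⊔_ 0 (map (λ q → f (proj₂ q)) p)

coeff-beyond : ∀ (f : SSC → ℕ) p K → maxOver f p < f K → coeff p K ≡ 0ℚ
coeff-beyond f p K max<fK = sumℚ-zero p λ {q} q∈ → when-no (K ≟SSC proj₂ q) (proj₁ q) λ { refl →
  ℕ.<-irrefl refl (ℕ.<-≤-trans max<fK (All.lookup (foldr-⊔-≥ (map (λ q → f (proj₂ q)) p)) (∈.∈-map⁺ (λ q → f (proj₂ q)) q∈))) }

-- One of the two factors of every term is too large to occur in p (resp. q).
productAt-large : ∀ p q C w → Increasing C →
  maxOver xDegree p + maxOver xDegree q < length w ⊎ maxOver θDegree p + maxOver θDegree q < length C →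
  productAt p q (C , w) ≡ 0ℚ
productAt-large p q C w C↑ large =
  sumℚ-zero (upTo (suc (length w))) λ {i} i∈ → sumℚ-zero (masks (length C)) λ {ms} ms∈ →
    term-zero large i ms (ℕ.≤-pred (∈.∈-upTo⁻ i∈)) (length-∈masks _ ms∈)
  where
  zeroˡ : ∀ s {x} y → x ≡ 0ℚ → sgn s ℚ.* x ℚ.* y ≡ 0ℚ
  zeroˡ s y refl = trans (cong (ℚ._* y) (ℚ.*-zeroʳ (sgn s))) (ℚ.*-zeroˡ y)
  zeroʳ : ∀ s x {y} → y ≡ 0ℚ → sgn s ℚ.* x ℚ.* y ≡ 0ℚ
  zeroʳ s x refl = ℚ.*-zeroʳ (sgn s ℚ.* x)
  Kˡ Kʳ : ℕ → Mask → SSC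
  Kˡ i ms = superpermOf (selectˡ ms C , take i w)
  Kʳ i ms = superpermOf (selectʳ ms C , drop i w)
  term-zero : maxOver xDegree p + maxOver xDegree q < length w ⊎ maxOver θDegree p + maxOver θDegree q < length C →
              ∀ i ms → i ≤ length w → length ms ≡ length C →
              sgn (maskInversions ms) ℚ.* coeff p (Kˡ i ms) ℚ.* coeff q (Kʳ i ms) ≡ 0ℚ
  term-zero (inj₁ large) i ms i≤w _ with i ℕ.≤? maxOver xDegree p
  ... | no i≰ = zeroˡ (maskInversions ms) (coeff q (Kʳ i ms)) (coeff-beyond xDegree p (Kˡ i ms)
    (subst (maxOver xDegree p <_) (sym (trans (xDegree-superpermOf (selectˡ ms C , take i w)) (trans (List.length-take i w) (ℕ.m≤n⇒m⊓n≡m i≤w)))) (ℕ.≰⇒> i≰)))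
  ... | yes i≤ = zeroʳ (maskInversions ms) (coeff p (Kˡ i ms)) (coeff-beyond xDegree q (Kʳ i ms)
    (subst (maxOver xDegree q <_) (sym (trans (xDegree-superpermOf (selectʳ ms C , drop i w)) (List.length-drop i w)))
      (ℕ.+-cancelˡ-< i _ _ (subst (i + maxOver xDegree q <_) (sym (ℕ.m+[n∸m]≡n i≤w))
        (ℕ.≤-<-trans (ℕ.+-monoˡ-≤ (maxOver xDegree q) i≤) large)))))
  term-zero (inj₂ large) i ms _ ms≡C with length (selectˡ ms C) ℕ.≤? maxOver θDegree p
  ... | no ℓ≰ = zeroˡ (maskInversions ms) (coeff q (Kʳ i ms)) (coeff-beyond θDegree p (Kˡ i ms)
    (subst (maxOver θDegree p <_) (sym (θDegree-superpermOf (selectˡ ms C) (take i w) (selectˡ-increasing ms C↑))) (ℕ.≰⇒> ℓ≰)))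
  ... | yes ℓ≤ = zeroʳ (maskInversions ms) (coeff p (Kˡ i ms)) (coeff-beyond θDegree q (Kʳ i ms)
    (subst (maxOver θDegree q <_) (sym (θDegree-superpermOf (selectʳ ms C) (drop i w) (selectʳ-increasing ms C↑)))
      (ℕ.+-cancelˡ-< (length (selectˡ ms C)) _ _ (subst (length (selectˡ ms C) + maxOver θDegree q <_) (sym (length-select ms C ms≡C))
        (ℕ.≤-<-trans (ℕ.+-monoˡ-≤ (maxOver θDegree q) ℓ≤) large)))))

↭-dec : ∀ {A : Set} → DecidableEquality A → (xs ys : List A) → Dec (xs ↭ ys)
↭-dec _≟_ [] [] = yes ↭-refl
↭-dec _≟_ [] (y ∷ ys) = no λ []↭ → case Perm.↭-empty-inv (↭-sym []↭) of λ ()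
↭-dec _≟_ (x ∷ xs) ys with DecMembership._∈?_ _≟_ x ys
... | no x∉ = no λ x∷xs↭ys → x∉ (Perm.∈-resp-↭ x∷xs↭ys (here refl))
... | yes x∈ with ∈.∈-∃++ x∈
...   | ys₁ , ys₂ , refl with ↭-dec _≟_ xs (ys₁ ++ ys₂)
...     | yes xs↭ = yes (↭-trans (prep x xs↭) (↭-sym (Perm.shift x ys₁ ys₂)))
...     | no xs≠ = no λ x∷xs↭ → xs≠ (Perm.drop-mid [] ys₁ x∷xs↭)

isSuperperm? : (I : SSC) → Dec (IsSuperperm I)
isSuperperm? I =
  (All.all? (λ B → ¬? (List.≡-dec ℕ._≟_ B []) ×-dec linked? ℕ._<?_ B) I
    ×-dec ↭-dec ℕ._≟_ (nonzeros I) (applyUpTo suc (length (nonzeros I))))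
  ×-dec All.all? (λ B → ¬? (DecMembership._∈?_ ℕ._≟_ 0 B) →-dec (length B ℕ.≟ 1)) I

sublists : List ℕ → List (List ℕ)
sublists [] = [] ∷ []
sublists (x ∷ xs) = map (x ∷_) (sublists xs) ++ sublists xs

sublists-complete : ∀ {xs B} → Increasing xs → Increasing B → All (_∈ xs) B → B ∈ sublists xs
sublists-complete {[]} {[]} _ _ _ = here refl
sublists-complete {[]} {_ ∷ _} _ _ (() ∷ _)
sublists-complete {x ∷ xs} {[]} (_ ∷ xs↑) _ _ = ∈.∈-++⁺ʳ (map (x ∷_) (sublists xs)) (sublists-complete xs↑ [] [])
sublists-complete {x ∷ xs} {b ∷ B} (x< ∷ xs↑) (b< ∷ B↑) (b∈ ∷ B⊆) with b ℕ.≟ x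
... | yes refl = ∈.∈-++⁺ˡ (∈.∈-map⁺ (x ∷_) (sublists-complete xs↑ B↑ (All.zipWith tail (b< , B⊆))))
  where
  tail : ∀ {t} → b < t × t ∈ b ∷ xs → t ∈ xs
  tail (b<t , here refl) = ⊥-elim (ℕ.<-irrefl refl b<t)
  tail (_ , there t∈) = t∈
... | no b≢x with b∈
...   | here b≡x = ⊥-elim (b≢x b≡x)
...   | there b∈xs = ∈.∈-++⁺ʳ (map (x ∷_) (sublists xs)) (sublists-complete xs↑ (b< ∷ B↑) (b∈xs ∷ All.zipWith tail (b< , B⊆)))
  where
  tail : ∀ {t} → b < t × t ∈ x ∷ xs → t ∈ xs
  tail (b<t , here refl) = ⊥-elim (ℕ.<-asym (All.lookup x< b∈xs) b<t)
  tail (_ , there t∈) = t∈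

listsUpTo : ∀ {A : Set} → ℕ → List A → List (List A)
listsUpTo zero xs = [] ∷ []
listsUpTo (suc n) xs = [] ∷ concatMap (λ x → map (x ∷_) (listsUpTo n xs)) xs

listsUpTo-complete : ∀ {A : Set} n (xs : List A) {ys} → length ys ≤ n → All (_∈ xs) ys → ys ∈ listsUpTo n xs
listsUpTo-complete zero xs {[]} _ _ = here refl
listsUpTo-complete (suc n) xs {[]} _ _ = here refl
listsUpTo-complete (suc n) xs {y ∷ ys} (s≤s ys≤n) (y∈ ∷ ys⊆) =
  there (∈.∈-concat⁺′ (∈.∈-map⁺ (y ∷_) (listsUpTo-complete n xs ys≤n ys⊆)) (∈.∈-map⁺ (λ x → map (x ∷_) (listsUpTo n xs)) y∈))

superpermsBelow : ℕ → ℕ → List SSC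
superpermsBelow n m = deduplicate _≟SSC_ (filter isSuperperm? (listsUpTo (n + m) (sublists (upTo (suc n)))))

superpermsBelow-unique : ∀ n m → Unique (superpermsBelow n m)
superpermsBelow-unique n m = deduplicate-! _≟SSC_ _

∈superpermsBelow⇒superperm : ∀ {n m K} → K ∈ superpermsBelow n m → IsSuperperm K
∈superpermsBelow⇒superperm {n} {m} K∈ =
  proj₂ (∈.∈-filter⁻ isSuperperm? {xs = listsUpTo (n + m) (sublists (upTo (suc n)))} (∈.∈-deduplicate⁻ _≟SSC_ _ K∈))

superperm-entry-≤ : ∀ {K B t} → IsSuperperm K → B ∈ K → t ∈ B → t ≤ xDegree K
superperm-entry-≤ {t = zero} _ _ _ = z≤n
superperm-entry-≤ {K} {B} {suc t} ((_ , nonzeros↭) , _) B∈ t∈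
  with ∈.∈-applyUpTo⁻ suc (Perm.∈-resp-↭ nonzeros↭ (∈.∈-concat⁺′ t∈nonzerosB (∈.∈-map⁺ blockNonzeros B∈)))
  where t∈nonzerosB = ∈.∈-filter⁺ (λ y → T? (not (y ≡ᵇ 0))) t∈ tt
... | _ , i<n , refl = i<n

length-≤-degrees : ∀ {K} → All (_≢ []) K → length K ≤ θDegree K + xDegree K
length-≤-degrees [] = z≤n
length-≤-degrees {B ∷ K} (B≢[] ∷ K≢[]) rewrite List.length-++ (blockNonzeros B) {nonzeros K} with isFerm B in θ
... | true = s≤s (ℕ.≤-trans (length-≤-degrees K≢[]) (ℕ.+-monoʳ-≤ (θDegree K) (ℕ.m≤n+m (xDegree K) _)))
... | false = ℕ.≤-trans (s≤s (length-≤-degrees K≢[]))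
  (subst (_≤ θDegree K + (length (blockNonzeros B) + xDegree K)) (ℕ.+-suc (θDegree K) (xDegree K))
    (ℕ.+-monoʳ-≤ (θDegree K) (ℕ.+-monoˡ-≤ (xDegree K) (nonzero-entry B B≢[] θ))))
  where
  nonzero-entry : ∀ B → B ≢ [] → isFerm B ≡ false → 1 ≤ length (blockNonzeros B)
  nonzero-entry [] B≢[] _ = ⊥-elim (B≢[] refl)
  nonzero-entry (suc t ∷ B) _ _ = s≤s z≤n

superpermsBelow-complete : ∀ {n m K} → IsSuperperm K → xDegree K ≤ n → θDegree K ≤ m → K ∈ superpermsBelow n m
superpermsBelow-complete {n} {m} {K} K-sp@((blocks , _) , _) K≤n K≤m =
  ∈.∈-deduplicate⁺ _≟SSC_ (∈.∈-filter⁺ isSuperperm? (listsUpTo-complete (n + m) _ length≤ blocks-sublists) K-sp)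
  where
  length≤ : length K ≤ n + m
  length≤ = ℕ.≤-trans (length-≤-degrees (All.map proj₁ blocks)) (subst (_≤ n + m) (ℕ.+-comm (xDegree K) (θDegree K)) (ℕ.+-mono-≤ K≤n K≤m))
  blocks-sublists : All (_∈ sublists (upTo (suc n))) K
  blocks-sublists = All.tabulate λ {B} B∈ → sublists-complete (upTo-increasing (suc n)) (Linked⇒Increasing (proj₂ (All.lookup blocks B∈)))
    (All.tabulate λ t∈ → ∈.∈-upTo⁺ (s≤s (ℕ.≤-trans (superperm-entry-≤ K-sp B∈ t∈) K≤n)))

product-closed : ∀ (p q : List (ℚ × SSC)) → AllSP p → AllSP q →
  Σ (List (ℚ × SSC)) λ r → AllSP r × (∀ u → NormalMono u → (toSeries (linQ p) ⋆ toSeries (linQ q)) u ≡ toSeries (linQ r) u)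
product-closed p q p-sp q-sp = r , r-sp , λ u u-normal → trans (⋆-productAt p-sp q-sp u u-normal) (sym (series-r u u-normal))
  where
  n = maxOver xDegree p + maxOver xDegree q
  m = maxOver θDegree p + maxOver θDegree q
  candidates = superpermsBelow n m
  r = map (λ K → productCoeff p q K , K) candidates
  r-sp : AllSP r
  r-sp = All.map⁺ (All.tabulate (∈superpermsBelow⇒superperm {n} {m}))
  open DecMembership _≟SSC_ using (_∈?_)
  series-r : ∀ u → NormalMono u → toSeries (linQ r) u ≡ productAt p q u
  series-r u@(C , w) C-linked = begin
    toSeries (linQ r) u
      ≡⟨ series-linQ r-sp u ⟩
    coeff r (superpermOf u)
      ≡⟨ sumℚ-map-map _ (λ K → productCoeff p q K , K) candidates ⟩
    sumℚ (map (λ K → when (superpermOf u ≟SSC K) (productCoeff p q K)) candidates)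
      ≡⟨ sumℚ-indicator _≟SSC_ (productCoeff p q) (superpermOf u) (superpermsBelow-unique n m) ⟩
    when (superpermOf u ∈? candidates) (productCoeff p q (superpermOf u))
      ≡⟨ by-candidacy (superpermOf u ∈? candidates) ⟩
    productAt p q u ∎
    where
    open ≡-Reasoning
    by-candidacy : (c? : Dec (superpermOf u ∈ candidates)) → when c? (productCoeff p q (superpermOf u)) ≡ productAt p q u
    by-candidacy (yes _) = sym (productAt≡productCoeff p q u C-linked)
    by-candidacy (no ∉candidates) = sym (productAt-large p q C w (Linked⇒Increasing C-linked) large)
      where
      large : n < length w ⊎ m < length C
      large with length w ℕ.≤? n | length C ℕ.≤? m
      ... | no w≰n | _ = inj₁ (ℕ.≰⇒> w≰n)
      ... | yes _ | no C≰m = inj₂ (ℕ.≰⇒> C≰m)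
      ... | yes w≤n | yes C≤m = ⊥-elim (∉candidates (superpermsBelow-complete (superpermOf-isSuperperm u)
              (subst (_≤ n) (sym (xDegree-superpermOf u)) w≤n)
              (subst (_≤ m) (sym (θDegree-superpermOf C w (Linked⇒Increasing C-linked))) C≤m)))

-- Standardization

countBelow : List ℕ → ℕ → ℕ
countBelow nz x = length (filterᵇ (λ y → y <ᵇ x) nz)

-- std J relabels every entry x of J by rank (nonzeros J) x.
rank : List ℕ → ℕ → ℕ
rank nz x = if x ≡ᵇ 0 then 0 else suc (countBelow nz x)

RankDomain : List ℕ → ℕ → Set
RankDomain nz x = x ∈ 0 ∷ nz

countBelow-mono : ∀ nz {x y} → x ≤ y → countBelow nz x ≤ countBelow nz y
countBelow-mono [] _ = z≤n
countBelow-mono (z ∷ nz) {x} {y} x≤y with z <ᵇ x in z<x | z <ᵇ y in z<y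
... | true | true = s≤s (countBelow-mono nz x≤y)
... | true | false = ⊥-elim (ℕ.<-irrefl refl (ℕ.<-≤-trans (ℕ.<-≤-trans (<ᵇ⇒< z<x) x≤y) (<ᵇ⇒≥ z<y)))
... | false | true = ℕ.m≤n⇒m≤1+n (countBelow-mono nz x≤y)
... | false | false = countBelow-mono nz x≤y

countBelow-strict : ∀ nz {x y} → x < y → x ∈ nz → countBelow nz x < countBelow nz y
countBelow-strict (z ∷ nz) {x} {y} x<y (here refl) rewrite <ᵇ-≥ {z} {z} ℕ.≤-refl | <ᵇ-< x<y =
  s≤s (countBelow-mono nz (ℕ.<⇒≤ x<y))
countBelow-strict (z ∷ nz) {x} {y} x<y (there x∈) with z <ᵇ x in z<x | z <ᵇ y in z<y
... | true | true = s≤s (countBelow-strict nz x<y x∈)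
... | true | false = ⊥-elim (ℕ.<-irrefl refl (ℕ.<-≤-trans (ℕ.<-trans (<ᵇ⇒< z<x) x<y) (<ᵇ⇒≥ z<y)))
... | false | true = s≤s (ℕ.<⇒≤ (countBelow-strict nz x<y x∈))
... | false | false = countBelow-strict nz x<y x∈

rank-strict : ∀ nz {x y} → x < y → RankDomain nz x → rank nz x < rank nz y
rank-strict nz {zero} {suc y} _ _ = s≤s z≤n
rank-strict nz {suc x} {suc y} x<y (there x∈) = s≤s (countBelow-strict nz x<y x∈)

rank-mono : ∀ nz {x y} → x ≤ y → rank nz x ≤ rank nz y
rank-mono nz {zero} _ = z≤n
rank-mono nz {suc x} {suc y} x≤y = s≤s (countBelow-mono nz x≤y)

rank-injective : ∀ nz {x y} → RankDomain nz x → RankDomain nz y → rank nz x ≡ rank nz y → x ≡ y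
rank-injective nz {x} {y} x∈ y∈ eq with ℕ.<-cmp x y
... | tri< x<y _ _ = ⊥-elim (ℕ.<-irrefl eq (rank-strict nz x<y x∈))
... | tri≈ _ x≡y _ = x≡y
... | tri> _ _ y<x = ⊥-elim (ℕ.<-irrefl (sym eq) (rank-strict nz y<x y∈))

RankDomain-concat : ∀ X {x} → x ∈ concat X → RankDomain (nonzeros X) x
RankDomain-concat X {zero} _ = here refl
RankDomain-concat X {suc x} x∈ with ∈.∈-concat⁻′ X x∈
... | B , x∈B , B∈ = there (∈.∈-concat⁺′ (∈.∈-filter⁺ (λ y → T? (not (y ≡ᵇ 0))) x∈B tt) (∈.∈-map⁺ blockNonzeros B∈))

RankDomain-entries : ∀ X → All (All (RankDomain (nonzeros X))) X
RankDomain-entries X = All.tabulate λ B∈ → All.tabulate λ t∈ → RankDomain-concat X (∈.∈-concat⁺′ t∈ B∈)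

PreservesZero : (ℕ → ℕ) → ℕ → Set
PreservesZero f t = (f t ≡ᵇ 0) ≡ (t ≡ᵇ 0)

rank-preservesZero : ∀ nz t → PreservesZero (rank nz) t
rank-preservesZero nz zero = refl
rank-preservesZero nz (suc t) = refl

relabel : (ℕ → ℕ) → SSC → SSC
relabel f = map (map f)

module _ (f : ℕ → ℕ) where

  isFerm-map : ∀ {B} → All (PreservesZero f) B → isFerm (map f B) ≡ isFerm B
  isFerm-map [] = refl
  isFerm-map (z ∷ zs) = cong₂ _∨_ z (isFerm-map zs)

  splitBlock-map : ∀ {B} → All (PreservesZero f) B → splitBlock (map f B) ≡ relabel f (splitBlock B)
  splitBlock-map {B} zs rewrite isFerm-map zs with isFerm B
  ... | true = refl
  ... | false = trans (sym (List.map-∘ B)) (List.map-∘ B)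

  splitBlocks-relabel : ∀ {X} → All (All (PreservesZero f)) X → splitBlocks (relabel f X) ≡ relabel f (splitBlocks X)
  splitBlocks-relabel [] = refl
  splitBlocks-relabel {B ∷ X} (z ∷ zs) =
    trans (cong₂ _++_ (splitBlock-map z) (splitBlocks-relabel zs)) (sym (List.map-++ (map f) (splitBlock B) (splitBlocks X)))

  blockNonzeros-map : ∀ {B} → All (PreservesZero f) B → blockNonzeros (map f B) ≡ map f (blockNonzeros B)
  blockNonzeros-map [] = refl
  blockNonzeros-map {t ∷ B} (z ∷ zs) with f t ≡ᵇ 0 | t ≡ᵇ 0
  ... | true | true = blockNonzeros-map zs
  ... | false | false = cong (f t ∷_) (blockNonzeros-map zs)

  nonzeros-relabel : ∀ {X} → All (All (PreservesZero f)) X → nonzeros (relabel f X) ≡ map f (nonzeros X)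
  nonzeros-relabel [] = refl
  nonzeros-relabel {B ∷ X} (z ∷ zs) =
    trans (cong₂ _++_ (blockNonzeros-map z) (nonzeros-relabel zs)) (sym (List.map-++ f (blockNonzeros B) (nonzeros X)))

  module _ {D : ℕ → Set} (strict : ∀ {x y} → D x → D y → x < y → f x < f y) where

    map-increasing : ∀ {B} → All D B → Increasing B → Increasing (map f B)
    map-increasing [] [] = []
    map-increasing (d ∷ ds) (b< ∷ B↑) = All.map⁺ (All.zipWith (λ (d′ , b<y) → strict d d′ b<y) (ds , b<)) ∷ map-increasing ds B↑

    wellFormed-relabel : ∀ {X} → All (All D) X → WellFormed X → WellFormed (relabel f X)
    wellFormed-relabel [] [] = []
    wellFormed-relabel (ds ∷ dss) ((B≢[] , B↑) ∷ X-wf) = (map≢[] B≢[] , map-increasing ds B↑) ∷ wellFormed-relabel dss X-wf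
      where
      map≢[] : ∀ {B} → B ≢ [] → map f B ≢ []
      map≢[] {[]} B≢[] _ = B≢[] refl
      map≢[] {_ ∷ _} _ ()

map-injectiveOn : ∀ {A B : Set} {D : A → Set} (f : A → B) → (∀ {x y} → D x → D y → f x ≡ f y → x ≡ y) →
                  ∀ {xs ys} → All D xs → All D ys → map f xs ≡ map f ys → xs ≡ ys
map-injectiveOn f inj [] [] _ = refl
map-injectiveOn f inj (dx ∷ dxs) (dy ∷ dys) eq = cong₂ _∷_ (inj dx dy (List.∷-injectiveˡ eq)) (map-injectiveOn f inj dxs dys (List.∷-injectiveʳ eq))

rank-preservesZero-all : ∀ nz (X : SSC) → All (All (PreservesZero (rank nz))) X
rank-preservesZero-all nz X = All.tabulate λ _ → All.tabulate λ {t} _ → rank-preservesZero nz t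

splitBlocks-std : ∀ X → splitBlocks (std X) ≡ std (splitBlocks X)
splitBlocks-std X = trans (splitBlocks-relabel (rank (nonzeros X)) (rank-preservesZero-all (nonzeros X) X))
                          (cong (λ nz → relabel (rank nz) (splitBlocks X)) (sym (nonzeros-splitBlocks X)))

nonzeros-std : ∀ X → nonzeros (std X) ≡ map (rank (nonzeros X)) (nonzeros X)
nonzeros-std X = nonzeros-relabel (rank (nonzeros X)) (rank-preservesZero-all (nonzeros X) X)

length-std : ∀ X → length (std X) ≡ length X
length-std X = List.length-map _ X

wellFormed-std : ∀ {X} → WellFormed X → WellFormed (std X)
wellFormed-std {X} = wellFormed-relabel (rank (nonzeros X)) (λ x∈ _ x<y → rank-strict (nonzeros X) x<y x∈) (RankDomain-entries X)

std-injective : ∀ {X X′} → nonzeros X ≡ nonzeros X′ → std X ≡ std X′ → X ≡ X′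
std-injective {X} {X′} nz≡ std≡ =
  map-injectiveOn (map (rank nz)) (map-injectiveOn (rank nz) (rank-injective nz))
    (RankDomain-entries X) (subst (λ nz′ → All (All (RankDomain nz′)) X′) (sym nz≡) (RankDomain-entries X′))
    (trans std≡ (cong (λ nz′ → relabel (rank nz′) X′) (sym nz≡)))
  where nz = nonzeros X

module SortNat = Sort ℕ.≤-decTotalOrder

Unique-++ˡ : ∀ {xs ys : List ℕ} → Unique (xs ++ ys) → Unique xs
Unique-++ˡ {[]} _ = []
Unique-++ˡ {x ∷ xs} (x∉ ∷ u) = All.++⁻ˡ xs x∉ ∷ Unique-++ˡ u

Unique-++ʳ : ∀ xs {ys : List ℕ} → Unique (xs ++ ys) → Unique ys
Unique-++ʳ [] u = u
Unique-++ʳ (x ∷ xs) (_ ∷ u) = Unique-++ʳ xs u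

Unique-↭ : ∀ {xs ys : List ℕ} → xs ↭ ys → Unique xs → Unique ys
Unique-↭ xs↭ys = PermSetoid.Unique-resp-↭ (setoid ℕ) (Perm.↭⇒↭ₛ xs↭ys)

positive-nonzeros : ∀ X → Positive (nonzeros X)
positive-nonzeros X = All-concatMap blockNonzeros X (λ {B} _ → positive-blockNonzeros B)

rank-↭-invariant : ∀ {xs ys} x → xs ↭ ys → rank xs x ≡ rank ys x
rank-↭-invariant x xs↭ys =
  cong (λ n → if x ≡ᵇ 0 then 0 else suc n) (Perm.↭-length (Perm.filter-↭ (λ y → T? (y <ᵇ x)) xs↭ys))

rank-increasing : ∀ {s} → Increasing s → Positive s → map (rank s) s ≡ applyUpTo suc (length s)
rank-increasing [] [] = refl
rank-increasing {suc x ∷ s} (x< ∷ s↑) (_ ∷ s>0)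
  rewrite <ᵇ-≥ {x} {x} ℕ.≤-refl | filterᵇ-none (λ y → y <ᵇ suc x) (All.map (λ x<y → <ᵇ-≥ (ℕ.<⇒≤ x<y)) x<) =
  cong (1 ∷_) (begin
    map (rank (suc x ∷ s)) s         ≡⟨ List.map-cong-local (All.zipWith (λ { {suc y} (x<y , _) → cong suc (count-head x<y) }) (x< , s>0)) ⟩
    map (λ y → suc (rank s y)) s     ≡⟨ List.map-∘ s ⟩
    map suc (map (rank s) s)         ≡⟨ cong (map suc) (rank-increasing s↑ s>0) ⟩
    map suc (applyUpTo suc (length s)) ≡⟨ List.map-applyUpTo suc suc (length s) ⟩
    applyUpTo (λ i → suc (suc i)) (length s) ∎)
  where
  open ≡-Reasoning
  count-head : ∀ {y} → suc x < suc y → countBelow (suc x ∷ s) (suc y) ≡ suc (countBelow s (suc y))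
  count-head (s≤s x<y) rewrite <ᵇ-< x<y = refl

rank-↭ : ∀ {nz} → Positive nz → Unique nz → map (rank nz) nz ↭ applyUpTo suc (length nz)
rank-↭ {nz} nz>0 nz-unique = begin
  map (rank nz) nz       ↭⟨ Perm.map⁺ (rank nz) (↭-sym (SortNat.sort-↭ nz)) ⟩
  map (rank nz) sorted   ≡⟨ List.map-cong-local (All.tabulate (λ {x} _ → rank-↭-invariant x (↭-sym (SortNat.sort-↭ nz)))) ⟩
  map (rank sorted) sorted ≡⟨ rank-increasing sorted↑ (Perm.All-resp-↭ (↭-sym (SortNat.sort-↭ nz)) nz>0) ⟩
  applyUpTo suc (length sorted) ≡⟨ cong (applyUpTo suc) (Perm.↭-length (SortNat.sort-↭ nz)) ⟩
  applyUpTo suc (length nz) ∎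
  where
  open Perm.PermutationReasoning
  sorted = SortNat.sort nz
  strict : ∀ {s} → AllPairs _≤_ s → Unique s → Increasing s
  strict [] [] = []
  strict (x≤ ∷ s≤) (x≢ ∷ s-unique) = All.zipWith (λ (x≤y , x≢y) → ℕ.≤∧≢⇒< x≤y x≢y) (x≤ , x≢) ∷ strict s≤ s-unique
  sorted↑ : Increasing sorted
  sorted↑ = strict (Linked.Linked⇒AllPairs ℕ.≤-trans (SortNat.sort-↗ nz)) (Unique-↭ (↭-sym (SortNat.sort-↭ nz)) nz-unique)

std-superperm : ∀ {X} → All (λ B → B ≢ [] × Linked _<_ B) X → SingletonsOrFermionic X → Unique (nonzeros X) → IsSuperperm (std X)
std-superperm {X} blocks X-ok nz-unique = (std-blocks , std-nonzeros↭) , std-ok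
  where
  f = rank (nonzeros X)
  std-blocks : All (λ B → B ≢ [] × Linked _<_ B) (std X)
  std-blocks = All.map (λ (B≢[] , B↑) → B≢[] , Linked.AllPairs⇒Linked B↑)
                       (wellFormed-std (All.map (λ (B≢[] , B-linked) → B≢[] , Linked⇒Increasing B-linked) blocks))
  length-nonzeros : length (nonzeros (std X)) ≡ length (nonzeros X)
  length-nonzeros = trans (cong length (nonzeros-std X)) (List.length-map f (nonzeros X))
  std-nonzeros↭ : nonzeros (std X) ↭ applyUpTo suc (length (nonzeros (std X)))
  std-nonzeros↭ = subst (λ n → nonzeros (std X) ↭ applyUpTo suc n) (sym length-nonzeros)
                        (↭-trans (↭-reflexive (nonzeros-std X)) (rank-↭ (positive-nonzeros X) nz-unique))
  std-ok : SingletonsOrFermionic (std X)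
  std-ok = All.map⁺ (All.map (λ {B} B-ok 0∉fB → trans (List.length-map f B) (B-ok (λ 0∈B → 0∉fB (∈.∈-map⁺ f 0∈B)))) X-ok)

superperm-nonzeros-unique : ∀ {I} → IsSuperperm I → Unique (nonzeros I)
superperm-nonzeros-unique ((_ , nonzeros↭) , _) =
  Unique-↭ (↭-sym nonzeros↭) (UniqueProp.applyUpTo⁺₁ suc _ (λ i<j _ → ℕ.<⇒≢ (s≤s i<j)))

nonzeros-take-drop : ∀ i X → nonzeros X ≡ nonzeros (take i X) ++ nonzeros (drop i X)
nonzeros-take-drop i X = trans (cong nonzeros (sym (List.take++drop≡id i X))) (List.concatMap-++ blockNonzeros (take i X) (drop i X))

superperm-std-take : ∀ i {I} → IsSuperperm I → IsSuperperm (std (take i I))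
superperm-std-take i {I} I-sp@((blocks , _) , I-ok) =
  std-superperm (All.take⁺ i blocks) (All.take⁺ i I-ok)
    (Unique-++ˡ (subst Unique (nonzeros-take-drop i I) (superperm-nonzeros-unique I-sp)))

superperm-std-drop : ∀ i {I} → IsSuperperm I → IsSuperperm (std (drop i I))
superperm-std-drop i {I} I-sp@((blocks , _) , I-ok) =
  std-superperm (All.drop⁺ i blocks) (All.drop⁺ i I-ok)
    (Unique-++ʳ (nonzeros (take i I)) (subst Unique (nonzeros-take-drop i I) (superperm-nonzeros-unique I-sp)))

search : List ℕ → List ℕ → ℕ → ℕ
search nz [] r = 0
search nz (y ∷ L) r = if rank nz y ≡ᵇ r then y else search nz L r

search-sound : ∀ nz {L r y} → y ∈ L → rank nz y ≡ r → search nz L r ∈ L × rank nz (search nz L r) ≡ r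
search-sound nz {z ∷ L} {r} y∈ ry≡r with rank nz z ≡ᵇ r in rz≡r
... | true = here refl , ≡ᵇ-sound rz≡r
... | false with y∈
...   | here refl with () ← trans (sym (≡ᵇ-refl r)) (trans (cong (_≡ᵇ r) (sym ry≡r)) rz≡r)
...   | there y∈L with search-sound nz y∈L ry≡r
...     | s∈L , rs≡r = there s∈L , rs≡r

unrank : List ℕ → ℕ → ℕ
unrank nz = search nz (0 ∷ nz)

unrank-rank : ∀ nz {x} → RankDomain nz x → unrank nz (rank nz x) ≡ x
unrank-rank nz x∈ with search-sound nz x∈ refl
... | y∈ , ry≡rx = rank-injective nz y∈ x∈ ry≡rx

RankImage : List ℕ → ℕ → Set
RankImage nz t = Σ ℕ λ x → RankDomain nz x × t ≡ rank nz x

rank-unrank : ∀ nz {t} → RankImage nz t → rank nz (unrank nz t) ≡ t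
rank-unrank nz (x , x∈ , refl) = cong (rank nz) (unrank-rank nz x∈)

unrank-strict : ∀ nz {t t′} → RankImage nz t → RankImage nz t′ → t < t′ → unrank nz t < unrank nz t′
unrank-strict nz {t} {t′} t∈ t′∈ t<t′ with ℕ.<-cmp (unrank nz t) (unrank nz t′)
... | tri< lt _ _ = lt
... | tri≈ _ eq _ = ⊥-elim (ℕ.<-irrefl (trans (sym (rank-unrank nz t∈)) (trans (cong (rank nz) eq) (rank-unrank nz t′∈))) t<t′)
... | tri> _ _ gt = ⊥-elim (ℕ.<-irrefl refl (ℕ.<-≤-trans t<t′
        (subst₂ _≤_ (rank-unrank nz t′∈) (rank-unrank nz t∈) (rank-mono nz (ℕ.<⇒≤ gt)))))

unrank-preservesZero : ∀ nz {t} → RankImage nz t → PreservesZero (unrank nz) t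
unrank-preservesZero nz (x , x∈ , refl) rewrite unrank-rank nz x∈ = sym (rank-preservesZero nz x)

relabel-∘ : ∀ (f g : ℕ → ℕ) {X} → All (All (λ x → g (f x) ≡ x)) X → relabel g (relabel f X) ≡ X
relabel-∘ f g {X} gf≡ = trans (sym (List.map-∘ X))
  (trans (List.map-cong-local (All.map (λ {B} gfB≡ → trans (sym (List.map-∘ B)) (trans (List.map-cong-local gfB≡) (List.map-id B))) gf≡))
         (List.map-id X))

-- The witness is K relabelled along the inverse of rank (nonzeros X).
unstandardize : ∀ X {K} → WellFormed K → splitBlocks K ≡ std X →
                Σ SSC λ K′ → WellFormed K′ × splitBlocks K′ ≡ X × std K′ ≡ K
unstandardize X {K} K-wf K≡stdX = relabel g K , K′-wf , splitBlocks-K′ , std-K′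
  where
  nz = nonzeros X
  f = rank nz
  g = unrank nz
  concat-K : concat K ≡ map f (concat X)
  concat-K = trans (sym (concat-splitBlocks K)) (trans (cong concat K≡stdX) (List.concat-map {f = f} X))
  K-image : All (All (RankImage nz)) K
  K-image = All.tabulate λ B∈ → All.tabulate λ t∈ → image (subst (_ ∈_) concat-K (∈.∈-concat⁺′ t∈ B∈))
    where
    image : ∀ {t} → t ∈ map f (concat X) → RankImage nz t
    image t∈ with ∈.∈-map⁻ f t∈
    ... | x , x∈ , refl = x , RankDomain-concat X x∈ , refl
  K′-wf : WellFormed (relabel g K)
  K′-wf = wellFormed-relabel g (unrank-strict nz) K-image K-wf
  splitBlocks-K′ : splitBlocks (relabel g K) ≡ X
  splitBlocks-K′ = begin
    splitBlocks (relabel g K)     ≡⟨ splitBlocks-relabel g (All.map (All.map (unrank-preservesZero nz)) K-image) ⟩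
    relabel g (splitBlocks K)     ≡⟨ cong (relabel g) K≡stdX ⟩
    relabel g (relabel f X)       ≡⟨ relabel-∘ f g (All.map (All.map (unrank-rank nz)) (RankDomain-entries X)) ⟩
    X ∎
    where open ≡-Reasoning
  std-K′ : std (relabel g K) ≡ K
  std-K′ = begin
    std (relabel g K)                ≡⟨ cong (λ nz′ → relabel (rank nz′) (relabel g K))
                                             (trans (sym (nonzeros-splitBlocks (relabel g K))) (cong nonzeros splitBlocks-K′)) ⟩
    relabel f (relabel g K)          ≡⟨ relabel-∘ g f (All.map (All.map (rank-unrank nz)) K-image) ⟩
    K ∎
    where open ≡-Reasoning

-- The coproduct

module _ {A : Set} where

  take-length-++ : ∀ (xs ys : List A) → take (length xs) (xs ++ ys) ≡ xs
  take-length-++ [] ys = refl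
  take-length-++ (x ∷ xs) ys = cong (x ∷_) (take-length-++ xs ys)

  drop-length-++ : ∀ (xs ys : List A) → drop (length xs) (xs ++ ys) ≡ ys
  drop-length-++ [] ys = refl
  drop-length-++ (x ∷ xs) ys = drop-length-++ xs ys

  length-take-≤ : ∀ {n} (xs : List A) → n ≤ length xs → length (take n xs) ≡ n
  length-take-≤ {n} xs n≤ = trans (List.length-take n xs) (ℕ.m≤n⇒m⊓n≡m n≤)

std-∈up : ∀ {X Y} → WellFormed X → splitBlocks X ≡ Y → std X ∈ up (std Y)
std-∈up {X} X-wf X≡Y = subst (λ Z → std X ∈ up Z) (trans (splitBlocks-std X) (cong std X≡Y)) (∈up-splitBlocks (wellFormed-std X-wf))

∈up-std : ∀ {X K} → WellFormed X → splitBlocks X ≡ X → K ∈ up (std X) → WellFormed K × splitBlocks K ≡ std X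
∈up-std {X} X-wf X-split K∈ with ∈up⇒splitBlocks (wellFormed-std X-wf) K∈
... | K-wf , K≡ = K-wf , trans K≡ (trans (splitBlocks-std X) (cong std X-split))

module Cut {I : SSC} (I-sp : IsSuperperm I) where

  private
    I-wf = superperm-wellFormed I-sp
    I-ok = proj₂ I-sp

    splitBlocks-take : ∀ i → splitBlocks (take i I) ≡ take i I
    splitBlocks-take i = splitBlocks-identity (All.take⁺ i I-ok)

    splitBlocks-drop : ∀ i → splitBlocks (drop i I) ≡ drop i I
    splitBlocks-drop i = splitBlocks-identity (All.drop⁺ i I-ok)

  cutPoint : SSC → ℕ → ℕ
  cutPoint J j = length (splitBlocks (take j J))

  splitBlocks-cut : ∀ {J} j → J ∈ up I → splitBlocks (take j J) ++ splitBlocks (drop j J) ≡ I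
  splitBlocks-cut {J} j J∈ = begin
    splitBlocks (take j J) ++ splitBlocks (drop j J) ≡⟨ splitBlocks-++ (take j J) (drop j J) ⟨
    splitBlocks (take j J ++ drop j J)               ≡⟨ cong splitBlocks (List.take++drop≡id j J) ⟩
    splitBlocks J                                    ≡⟨ proj₂ (∈up⇒splitBlocks I-wf J∈) ⟩
    splitBlocks I                                    ≡⟨ superperm-splitBlocks I-sp ⟩
    I ∎
    where open ≡-Reasoning

  splitBlocks-take-cut : ∀ {J} j → J ∈ up I → splitBlocks (take j J) ≡ take (cutPoint J j) I
  splitBlocks-take-cut {J} j J∈ =
    trans (sym (take-length-++ _ (splitBlocks (drop j J)))) (cong (take (cutPoint J j)) (splitBlocks-cut j J∈))

  splitBlocks-drop-cut : ∀ {J} j → J ∈ up I → splitBlocks (drop j J) ≡ drop (cutPoint J j) I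
  splitBlocks-drop-cut {J} j J∈ =
    trans (sym (drop-length-++ (splitBlocks (take j J)) _)) (cong (drop (cutPoint J j)) (splitBlocks-cut j J∈))

  cutPoint-≤ : ∀ {J} j → J ∈ up I → cutPoint J j ≤ length I
  cutPoint-≤ {J} j J∈ = subst (λ Z → cutPoint J j ≤ length Z) (splitBlocks-cut j J∈)
    (subst (cutPoint J j ≤_) (sym (List.length-++ (splitBlocks (take j J)))) (ℕ.m≤m+n _ _))

  cut-∈up : ∀ {J} j → J ∈ up I →
            std (take j J) ∈ up (std (take (cutPoint J j) I)) × std (drop j J) ∈ up (std (drop (cutPoint J j) I))
  cut-∈up {J} j J∈ with ∈up⇒splitBlocks I-wf J∈
  ... | J-wf , _ = std-∈up (All.take⁺ j J-wf) (splitBlocks-take-cut j J∈) , std-∈up (All.drop⁺ j J-wf) (splitBlocks-drop-cut j J∈)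

  glue-∈up : ∀ i {K L} → K ∈ up (std (take i I)) → L ∈ up (std (drop i I)) →
             Σ SSC λ J → Σ ℕ λ j → J ∈ up I × j ≤ length J × std (take j J) ≡ K × std (drop j J) ≡ L
  glue-∈up i K∈ L∈
    with ∈up-std (All.take⁺ i I-wf) (splitBlocks-take i) K∈ | ∈up-std (All.drop⁺ i I-wf) (splitBlocks-drop i) L∈
  ... | K-wf , K≡ | L-wf , L≡ with unstandardize (take i I) K-wf K≡ | unstandardize (drop i I) L-wf L≡
  ... | K′ , K′-wf , K′≡ , std-K′ | L′ , L′-wf , L′≡ , std-L′ =
    K′ ++ L′ , length K′ , J∈ , subst (length K′ ≤_) (sym (List.length-++ K′)) (ℕ.m≤m+n _ _) ,
    trans (cong std (take-length-++ K′ L′)) std-K′ , trans (cong std (drop-length-++ K′ L′)) std-L′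
    where
    J∈ : K′ ++ L′ ∈ up I
    J∈ = subst (λ Z → K′ ++ L′ ∈ up Z) (trans (splitBlocks-++ K′ L′) (trans (cong₂ _++_ K′≡ L′≡) (List.take++drop≡id i I)))
               (∈up-splitBlocks (All.++⁺ K′-wf L′-wf))

  length-splitBlocks-∈up : ∀ {i K} → i ≤ length I → K ∈ up (std (take i I)) → length (splitBlocks K) ≡ i
  length-splitBlocks-∈up {i} i≤ K∈ with ∈up-std (All.take⁺ i I-wf) (splitBlocks-take i) K∈
  ... | _ , K≡ = trans (cong length K≡) (trans (length-std (take i I)) (length-take-≤ I i≤))

  cut-injective : ∀ {J j J′ j′} → J ∈ up I → J′ ∈ up I → j ≤ length J → j′ ≤ length J′ →
                  std (take j J) ≡ std (take j′ J′) → std (drop j J) ≡ std (drop j′ J′) → J ≡ J′ × j ≡ j′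
  cut-injective {J} {j} {J′} {j′} J∈ J′∈ j≤ j′≤ take≡ drop≡ = J≡J′ , j≡j′
    where
    j≡j′ : j ≡ j′
    j≡j′ = trans (sym (length-take-≤ J j≤)) (trans (sym (length-std (take j J)))
             (trans (cong length take≡) (trans (length-std (take j′ J′)) (length-take-≤ J′ j′≤))))
    cut≡ : cutPoint J j ≡ cutPoint J′ j′
    cut≡ = trans (sym (length-std (splitBlocks (take j J)))) (trans (cong length (sym (splitBlocks-std (take j J))))
             (trans (cong (λ Z → length (splitBlocks Z)) take≡) (trans (cong length (splitBlocks-std (take j′ J′))) (length-std (splitBlocks (take j′ J′))))))
    same-nonzeros : ∀ X X′ → splitBlocks X ≡ splitBlocks X′ → nonzeros X ≡ nonzeros X′
    same-nonzeros X X′ eq = trans (sym (nonzeros-splitBlocks X)) (trans (cong nonzeros eq) (nonzeros-splitBlocks X′))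
    take≡take : take j J ≡ take j′ J′
    take≡take = std-injective {take j J} {take j′ J′} (same-nonzeros (take j J) (take j′ J′) (trans (splitBlocks-take-cut j J∈)
                  (trans (cong (λ c → take c I) cut≡) (sym (splitBlocks-take-cut j′ J′∈))))) take≡
    drop≡drop : drop j J ≡ drop j′ J′
    drop≡drop = std-injective {drop j J} {drop j′ J′} (same-nonzeros (drop j J) (drop j′ J′) (trans (splitBlocks-drop-cut j J∈)
                  (trans (cong (λ c → drop c I) cut≡) (sym (splitBlocks-drop-cut j′ J′∈))))) drop≡
    J≡J′ : J ≡ J′
    J≡J′ = trans (sym (List.take++drop≡id j J)) (trans (cong₂ _++_ take≡take drop≡drop) (List.take++drop≡id j′ J′))

module CoproductCoefficient {I : SSC} (I-sp : IsSuperperm I) (c : ℚ) (K L : SSC) where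
  open Cut I-sp
  open DecMembership _≟SSC_ using (_∈?_)

  term : SSC → SSC → ℚ
  term K′ L′ = when ((K′ ≟SSC K) ×-dec (L′ ≟SSC L)) c

  term-≢ : ∀ K′ L′ → ¬ (K′ ≡ K × L′ ≡ L) → term K′ L′ ≡ 0ℚ
  term-≢ K′ L′ = when-no ((K′ ≟SSC K) ×-dec (L′ ≟SSC L)) c

  term-≡ : term K L ≡ c
  term-≡ = when-yes ((K ≟SSC K) ×-dec (L ≟SSC L)) c (refl , refl)

  cutSum : SSC → ℚ
  cutSum J = sumℚ (map (λ j → term (std (take j J)) (std (drop j J))) (upTo (suc (length J))))

  pieceSum : ℕ → ℚ
  pieceSum i = sumℚ (map (λ K′ → sumℚ (map (term K′) (up (std (drop i I))))) (up (std (take i I))))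

  Splits : ℕ → Set
  Splits i = K ∈ up (std (take i I)) × L ∈ up (std (drop i I))

  pieceSum-no : ∀ i → ¬ Splits i → pieceSum i ≡ 0ℚ
  pieceSum-no i ¬splits = sumℚ-zero (up (std (take i I))) λ {K′} K′∈ → sumℚ-zero (up (std (drop i I))) λ {L′} L′∈ →
    term-≢ K′ L′ (λ { (refl , refl) → ¬splits (K′∈ , L′∈) })

  pieceSum-yes : ∀ i → Splits i → pieceSum i ≡ c
  pieceSum-yes i (K∈ , L∈) =
    trans (sumℚ-single (up-unique _) K∈ (λ {K′} _ K′≢K → sumℚ-zero (up (std (drop i I))) (λ {L′} _ → term-≢ K′ L′ (λ (K′≡K , _) → K′≢K K′≡K))))
          (trans (sumℚ-single (up-unique _) L∈ (λ {L′} _ L′≢L → term-≢ K L′ (λ (_ , L′≡L) → L′≢L L′≡L))) term-≡)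

  cutSums-no : (∀ i → i ∈ upTo (suc (length I)) → ¬ Splits i) → sumℚ (map cutSum (up I)) ≡ 0ℚ
  cutSums-no ¬splits = sumℚ-zero (up I) λ {J} J∈ → sumℚ-zero (upTo (suc (length J))) λ {j} _ →
    term-≢ (std (take j J)) (std (drop j J)) λ (K≡ , L≡) → ¬splits (cutPoint J j) (∈.∈-upTo⁺ (s≤s (cutPoint-≤ j J∈)))
                           (subst₂ (λ K′ L′ → K′ ∈ _ × L′ ∈ _) K≡ L≡ (cut-∈up j J∈))

  pieceSums-no : (∀ i → i ∈ upTo (suc (length I)) → ¬ Splits i) → sumℚ (map pieceSum (upTo (suc (length I)))) ≡ 0ℚ
  pieceSums-no ¬splits = sumℚ-zero (upTo (suc (length I))) λ {i} i∈ → pieceSum-no i (¬splits i i∈)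

  module _ {i₀} (i₀≤ : i₀ ≤ length I) (splits : Splits i₀) where

    pieceSums-yes : sumℚ (map pieceSum (upTo (suc (length I)))) ≡ c
    pieceSums-yes =
      trans (sumℚ-single (UniqueProp.upTo⁺ _) (∈.∈-upTo⁺ (s≤s i₀≤)) λ {i} i∈ i≢i₀ → pieceSum-no i λ (K∈ , _) →
               i≢i₀ (trans (sym (length-splitBlocks-∈up (ℕ.≤-pred (∈.∈-upTo⁻ i∈)) K∈)) (length-splitBlocks-∈up i₀≤ (proj₁ splits))))
            (pieceSum-yes i₀ splits)

    cutSums-yes : sumℚ (map cutSum (up I)) ≡ c
    cutSums-yes with glue-∈up i₀ (proj₁ splits) (proj₂ splits)
    ... | J₀ , j₀ , J₀∈ , j₀≤ , K≡ , L≡ =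
      trans (sumℚ-single (up-unique I) J₀∈ λ {J} J∈ J≢J₀ → sumℚ-zero (upTo (suc (length J))) λ {j} j∈ →
               term-≢ (std (take j J)) (std (drop j J)) λ (K′≡ , L′≡) → J≢J₀ (proj₁ (cut-injective J∈ J₀∈ (ℕ.≤-pred (∈.∈-upTo⁻ j∈)) j₀≤ (trans K′≡ (sym K≡)) (trans L′≡ (sym L≡)))))
     (trans (sumℚ-single (UniqueProp.upTo⁺ _) (∈.∈-upTo⁺ (s≤s j₀≤)) λ {j} j∈ j≢j₀ →
               term-≢ (std (take j J₀)) (std (drop j J₀)) λ (K′≡ , L′≡) → j≢j₀ (proj₂ (cut-injective J₀∈ J₀∈ (ℕ.≤-pred (∈.∈-upTo⁻ j∈)) j₀≤ (trans K′≡ (sym K≡)) (trans L′≡ (sym L≡)))))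
            (trans (cong₂ term K≡ L≡) term-≡))

  cutSums≡pieceSums : sumℚ (map cutSum (up I)) ≡ sumℚ (map pieceSum (upTo (suc (length I))))
  cutSums≡pieceSums with any? (λ i → (K ∈? up (std (take i I))) ×-dec (L ∈? up (std (drop i I)))) (upTo (suc (length I)))
  ... | yes some with find some
  ...   | i₀ , i₀∈ , splits = trans (cutSums-yes (ℕ.≤-pred (∈.∈-upTo⁻ i₀∈)) splits) (sym (pieceSums-yes (ℕ.≤-pred (∈.∈-upTo⁻ i₀∈)) splits))
  cutSums≡pieceSums | no none = trans (cutSums-no ¬splits) (sym (pieceSums-no ¬splits))
    where
    ¬splits : ∀ i → i ∈ upTo (suc (length I)) → ¬ Splits i
    ¬splits i i∈ splits = none (lose i∈ splits)

cuts : ℚ × SSC → LinM⊗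
cuts q = map (λ i → proj₁ q , std (take i (proj₂ q)) , std (drop i (proj₂ q))) (upTo (suc (length (proj₂ q))))

pieces : ℚ × SSC × SSC → LinM⊗
pieces q = concatMap (λ K → map (λ L → proj₁ q , K , L) (up (proj₂ (proj₂ q)))) (up (proj₁ (proj₂ q)))

scaledQ : ℚ × SSC → LinM
scaledQ q = map (λ q′ → proj₁ q ℚ.* proj₁ q′ , proj₂ q′) (Q (proj₂ q))

cuts-superperm : ∀ c {I} → IsSuperperm I → AllSP⊗ (cuts (c , I))
cuts-superperm c {I} I-sp = All.map⁺ (both (upTo (suc (length I))))
  where
  both : ∀ is → All (λ i → IsSuperperm (std (take i I)) × IsSuperperm (std (drop i I))) is
  both [] = []
  both (i ∷ is) = (superperm-std-take i I-sp , superperm-std-drop i I-sp) ∷ both is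

coef⊗-term : SSC → SSC → ℚ × SSC × SSC → ℚ
coef⊗-term K L q = when ((proj₁ (proj₂ q) ≟SSC K) ×-dec (proj₂ (proj₂ q) ≟SSC L)) (proj₁ q)

module _ {I : SSC} (I-sp : IsSuperperm I) (c : ℚ) (K L : SSC) where
  open CoproductCoefficient

  Δ-scaledQ : sumℚ (map (coef⊗-term K L) (concatMap cuts (scaledQ (c , I)))) ≡ sumℚ (map (cutSum I-sp c K L) (up I))
  Δ-scaledQ = begin
    sumℚ (map (coef⊗-term K L) (concatMap cuts (map (λ q → c ℚ.* proj₁ q , proj₂ q) (map (1ℚ ,_) (up I)))))
      ≡⟨ sumℚ-concatMap (coef⊗-term K L) cuts (map (λ q → c ℚ.* proj₁ q , proj₂ q) (map (1ℚ ,_) (up I))) ⟩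
    sumℚ (map (λ q → sumℚ (map (coef⊗-term K L) (cuts q))) (map (λ q → c ℚ.* proj₁ q , proj₂ q) (map (1ℚ ,_) (up I))))
      ≡⟨ sumℚ-map-map (λ q → sumℚ (map (coef⊗-term K L) (cuts q))) (λ q → c ℚ.* proj₁ q , proj₂ q) (map (1ℚ ,_) (up I)) ⟩
    sumℚ (map (λ q → sumℚ (map (coef⊗-term K L) (cuts (c ℚ.* proj₁ q , proj₂ q)))) (map (1ℚ ,_) (up I)))
      ≡⟨ sumℚ-map-map (λ q → sumℚ (map (coef⊗-term K L) (cuts (c ℚ.* proj₁ q , proj₂ q)))) (1ℚ ,_) (up I) ⟩
    sumℚ (map (λ J → sumℚ (map (coef⊗-term K L) (cuts (c ℚ.* 1ℚ , J)))) (up I))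
      ≡⟨ sumℚ-cong (up I) (λ {J} _ → sumℚ-map-map (coef⊗-term K L) (λ i → c ℚ.* 1ℚ , std (take i J) , std (drop i J)) (upTo (suc (length J)))) ⟩
    sumℚ (map (cutSum I-sp (c ℚ.* 1ℚ) K L) (up I))
      ≡⟨ cong (λ c′ → sumℚ (map (cutSum I-sp c′ K L) (up I))) (ℚ.*-identityʳ c) ⟩
    sumℚ (map (cutSum I-sp c K L) (up I)) ∎
    where open ≡-Reasoning

  pieces-cuts : sumℚ (map (coef⊗-term K L) (concatMap pieces (cuts (c , I)))) ≡ sumℚ (map (pieceSum I-sp c K L) (upTo (suc (length I))))
  pieces-cuts = begin
    sumℚ (map (coef⊗-term K L) (concatMap pieces (cuts (c , I))))
      ≡⟨ sumℚ-concatMap (coef⊗-term K L) pieces (cuts (c , I)) ⟩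
    sumℚ (map (λ q → sumℚ (map (coef⊗-term K L) (pieces q))) (cuts (c , I)))
      ≡⟨ sumℚ-map-map (λ q → sumℚ (map (coef⊗-term K L) (pieces q))) (λ i → c , std (take i I) , std (drop i I)) (upTo (suc (length I))) ⟩
    sumℚ (map (λ i → sumℚ (map (coef⊗-term K L) (pieces (c , std (take i I) , std (drop i I))))) (upTo (suc (length I))))
      ≡⟨ sumℚ-cong (upTo (suc (length I))) (λ {i} _ →
           trans (sumℚ-concatMap (coef⊗-term K L) (λ K′ → map (λ L′ → c , K′ , L′) (up (std (drop i I)))) (up (std (take i I))))
                 (sumℚ-cong (up (std (take i I))) (λ {K′} _ → sumℚ-map-map (coef⊗-term K L) (λ L′ → c , K′ , L′) (up (std (drop i I)))))) ⟩
    sumℚ (map (pieceSum I-sp c K L) (upTo (suc (length I)))) ∎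
    where open ≡-Reasoning

  Δ-Q : sumℚ (map (coef⊗-term K L) (concatMap cuts (scaledQ (c , I)))) ≡ sumℚ (map (coef⊗-term K L) (concatMap pieces (cuts (c , I))))
  Δ-Q = trans Δ-scaledQ (trans (CoproductCoefficient.cutSums≡pieceSums I-sp c K L) (sym pieces-cuts))

coproduct-closed : ∀ (p : List (ℚ × SSC)) → AllSP p →
  Σ (List (ℚ × SSC × SSC)) λ r → AllSP⊗ r × (∀ K L → coef⊗ (Δ (linQ p)) K L ≡ coef⊗ (linQ⊗ r) K L)
coproduct-closed p p-sp = concatMap cuts p , All-concatMap cuts p (λ {(c , I)} q∈ → cuts-superperm c (All.lookup p-sp q∈)) , coef≡
  where
  coef≡ : ∀ K L → coef⊗ (Δ (linQ p)) K L ≡ coef⊗ (linQ⊗ (concatMap cuts p)) K L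
  coef≡ K L = begin
    sumℚ (map (coef⊗-term K L) (concatMap cuts (concatMap scaledQ p)))
      ≡⟨ cong (λ t → sumℚ (map (coef⊗-term K L) t)) (concatMap-concatMap cuts scaledQ p) ⟩
    sumℚ (map (coef⊗-term K L) (concatMap (λ q → concatMap cuts (scaledQ q)) p))
      ≡⟨ sumℚ-concatMap (coef⊗-term K L) (λ q → concatMap cuts (scaledQ q)) p ⟩
    sumℚ (map (λ q → sumℚ (map (coef⊗-term K L) (concatMap cuts (scaledQ q)))) p)
      ≡⟨ sumℚ-cong p (λ {(c , I)} q∈ → Δ-Q (All.lookup p-sp q∈) c K L) ⟩
    sumℚ (map (λ q → sumℚ (map (coef⊗-term K L) (concatMap pieces (cuts q)))) p)
      ≡⟨ sumℚ-concatMap (coef⊗-term K L) (λ q → concatMap pieces (cuts q)) p ⟨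
    sumℚ (map (coef⊗-term K L) (concatMap (λ q → concatMap pieces (cuts q)) p))
      ≡⟨ cong (λ t → sumℚ (map (coef⊗-term K L) t)) (concatMap-concatMap pieces cuts p) ⟨
    sumℚ (map (coef⊗-term K L) (concatMap pieces (concatMap cuts p))) ∎
    where open ≡-Reasoning

proposition5p5 :
    -- unit: 1 ∈ sFQSym
    (Σ (List (ℚ × SSC)) λ r → AllSP r × (∀ u → NormalMono u → toSeries (linQ r) u ≡ oneS u))
    -- product: sFQSym · sFQSym ⊆ sFQSym
    × (∀ (p q : List (ℚ × SSC)) → AllSP p → AllSP q →
         Σ (List (ℚ × SSC)) λ r → AllSP r ×
           (∀ u → NormalMono u →
              (toSeries (linQ p) ⋆ toSeries (linQ q)) u ≡ toSeries (linQ r) u))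
    -- coproduct: Δ(sFQSym) ⊆ sFQSym ⊗ sFQSym
    × (∀ (p : List (ℚ × SSC)) → AllSP p →
         Σ (List (ℚ × SSC × SSC)) λ r → AllSP⊗ r ×
           (∀ K L → coef⊗ (Δ (linQ p)) K L ≡ coef⊗ (linQ⊗ r) K L))
proposition5p5 = unit-closed , product-closed , coproduct-closed
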